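{- Fix an integer $n\geq 1$. Let $X_n=[a_0,\overline{a_1,a_2}]$ be a continued fraction of type $(1,2)$ with $a_0,a_1,a_2\in\mathbb{Z}[X_{n-1}]$. Then there exists $\varepsilon\in RE_n^+$ such that $a_0=(p(\varepsilon)-1)/q(\varepsilon)$, $a_1=q(\varepsilon)$, $a_2=2(p(\varepsilon)-1)/q(\varepsilon)$, and $p(\varepsilon)q(\varepsilon)>0$. Conversely, if $\varepsilon\in RE_n^+$ satisfies $q(\varepsilon)\mid p(\varepsilon)-1$ in $\mathbb{Z}[X_{n-1}]$ and $p(\varepsilon)q(\varepsilon)>0$, then $$X_n=\left[\frac{p(\varepsilon)-1}{q(\varepsilon)},\overline{q(\varepsilon),\,2\frac{p(\varepsilon)-1}{q(\varepsilon)}}\right].$$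
   Context: For $m\geq 0$ let $X_m=2\cos(2\pi/2^{m+2})$ (so $X_0=0$ and $X_m=\sqrt{2+X_{m-1}}$), viewed as real numbers; $\mathbb{Z}[X_m]$ is the ring of integers of $\mathbb{Q}(X_m)$. Every $x\in\mathbb{Z}[X_n]$ can be written uniquely as $x=p(x)+X_nq(x)$ with $p(x),q(x)\in\mathbb{Z}[X_{n-1}]$. The relative norm is $N_{n/n-1}(x)=p(x)^2-X_n^2q(x)^2$, and $RE_n^+=\{\varepsilon\in\mathbb{Z}[X_n]: N_{n/n-1}(\varepsilon)=1\}$. For a sequence $c_0,c_1,\dots$ in $\mathbb{Z}[X_{n-1}]$ define $p_k,q_k$ by $\begin{pmatrix}p_k & p_{k-1}\\ q_k & q_{k-1}\end{pmatrix}=\begin{pmatrix}c_0&1\\1&0\end{pmatrix}\cdots\begin{pmatrix}c_k&1\\1&0\end{pmatrix}$; $[c_0,c_1,\dots]$ denotes the real limit of $p_k/q_k$, and "$X_n=[c_0,c_1,\dots]$" means this limit exists and equals $X_n$. The notation $[c_0,\overline{c_1,c_2}]$ means the sequence $c_0,c_1,c_2,c_1,c_2,\dots$; a periodic sequence has type $(N,\ell)$ if $N\geq0$, $\ell\geq1$ are minimal with $c_{k+\ell}=c_k$ for all $k\geq N$. -}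

module Defs where

open import Data.Nat using (ℕ; zero; suc; _≤_)
open import Data.Integer as ℤ using (ℤ; +_; -[1+_])
open import Data.Product using (_×_; _,_; proj₁; proj₂; Σ; ∃)
open import Relation.Binary.PropositionalEquality using (_≡_)

-- The ring Z[X_n], X_n = 2cos(2π/2^{n+2}), as iterated pairs.
-- R 0 = ℤ  (X_0 = 0), and an element (p , q) of R (suc n) stands for
-- p + X_{n+1} q with p q ∈ Z[X_n]; multiplication uses X_{n+1}² = 2 + X_n.
-- This representation is exactly the unique decomposition x = p(x) + X_n q(x).

R : ℕ → Set
R zero    = ℤ
R (suc n) = R n × R n

𝟘 : ∀ {n} → R n
𝟘 {zero}  = + 0
𝟘 {suc n} = 𝟘 , 𝟘

𝟙 : ∀ {n} → R n
𝟙 {zero}  = + 1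
𝟙 {suc n} = 𝟙 , 𝟘

infixl 6 _⊕_ _⊝_
infixl 7 _⊗_
infix 4 _<ᴿ_

_⊕_ : ∀ {n} → R n → R n → R n
_⊕_ {zero}  a b = a ℤ.+ b
_⊕_ {suc n} (p₁ , q₁) (p₂ , q₂) = p₁ ⊕ p₂ , q₁ ⊕ q₂

⊖_ : ∀ {n} → R n → R n
⊖_ {zero}  a = ℤ.- a
⊖_ {suc n} (p , q) = ⊖ p , ⊖ q

_⊝_ : ∀ {n} → R n → R n → R n
x ⊝ y = x ⊕ (⊖ y)

two : ∀ {n} → R n
two = 𝟙 ⊕ 𝟙

X : (n : ℕ) → R n
X zero    = + 0
X (suc n) = 𝟘 , 𝟙

_⊗_ : ∀ {n} → R n → R n → R n
_⊗_ {zero}  a b = a ℤ.* b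
_⊗_ {suc n} (p₁ , q₁) (p₂ , q₂) =
  p₁ ⊗ p₂ ⊕ (two ⊕ X n) ⊗ (q₁ ⊗ q₂) , p₁ ⊗ q₂ ⊕ q₁ ⊗ p₂

fromℤ : ∀ {n} → ℤ → R n
fromℤ {zero}  z = z
fromℤ {suc n} z = fromℤ z , 𝟘

ι : ∀ {n} → R n → R (suc n)
ι x = x , 𝟘

p : ∀ {n} → R (suc n) → R n
p = proj₁

q : ∀ {n} → R (suc n) → R n
q = proj₂

Nrel : ∀ {n} → R (suc n) → R n
Nrel {n} x = p x ⊗ p x ⊝ (two ⊕ X n) ⊗ (q x ⊗ q x)

InRE⁺ : ∀ {n} → R (suc n) → Set
InRE⁺ ε = Nrel ε ≡ 𝟙

-- Sign of an element of Z[X_n] viewed as a real number (X_n > 0 real).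
-- For x = p + X q with p, q of opposite (nonzero) signs, the sign of x is
-- the sign of p if p² > X² q² and the sign of q if p² < X² q².

data Sgn : Set where
  neg zer pos : Sgn

sgnℤ : ℤ → Sgn
sgnℤ (+ zero)  = zer
sgnℤ (+ suc _) = pos
sgnℤ -[1+ _ ]  = neg

combine : Sgn → Sgn → Sgn → Sgn
combine s   zer _   = s
combine zer t   _   = t
combine pos pos _   = pos
combine neg neg _   = neg
combine s   t   pos = s
combine s   t   neg = t
combine s   t   zer = zer

sgn : ∀ {n} → R n → Sgn
sgn {zero}  a = sgnℤ a
sgn {suc n} (a , b) = combine (sgn a) (sgn b) (sgn (Nrel {n} (a , b)))

Pos : ∀ {n} → R n → Set
Pos x = sgn x ≡ pos

_<ᴿ_ : ∀ {n} → R n → R n → Set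
x <ᴿ y = Pos (y ⊝ x)

abs : ∀ {n} → R n → R n
abs x with sgn x
... | neg = ⊖ x
... | _   = x

Divides : ∀ {n} → R n → R n → Set
Divides {n} a b = Σ (R n) λ c → b ≡ a ⊗ c

quot : ∀ {n} {a b : R n} → Divides a b → R n
quot = proj₁

record Mat (A : Set) : Set where
  constructor mat
  field
    m₁₁ m₁₂ m₂₁ m₂₂ : A
open Mat public

_·_ : ∀ {n} → Mat (R n) → Mat (R n) → Mat (R n)
mat a b c d · mat e f g h = mat (a ⊗ e ⊕ b ⊗ g) (a ⊗ f ⊕ b ⊗ h) (c ⊗ e ⊕ d ⊗ g) (c ⊗ f ⊕ d ⊗ h)

elemMat : ∀ {n} → R n → Mat (R n)
elemMat c = mat c 𝟙 𝟙 𝟘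

-- (p_k p_{k-1} ; q_k q_{k-1}) = (c_0 1;1 0) ⋯ (c_k 1;1 0)
convMat : ∀ {n} → (ℕ → R n) → ℕ → Mat (R n)
convMat c zero    = elemMat (c zero)
convMat c (suc k) = convMat c k · elemMat (c (suc k))

pconv : ∀ {n} → (ℕ → R n) → ℕ → R n
pconv c k = m₁₁ (convMat c k)

qconv : ∀ {n} → (ℕ → R n) → ℕ → R n
qconv c k = m₂₁ (convMat c k)

-- "x = [c_0, c_1, ...]": p_k/q_k → x in ℝ, i.e. for every M ≥ 1 there is K
-- such that for all k ≥ K, q_k ≠ 0 and |p_k/q_k - x| < 1/M, written
-- without division as  M·|p_k - x q_k| < |q_k|  (which forces q_k ≠ 0).
CFEquals : ∀ {m} → R (suc m) → (ℕ → R m) → Set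
CFEquals {m} x c =
  ∀ (M : ℕ) → ∃ λ K → ∀ k → K ≤ k →
    fromℤ (+ suc M) ⊗ abs (ι (pconv c k) ⊝ x ⊗ ι (qconv c k)) <ᴿ abs (ι (qconv c k))

PeriodicFrom : ∀ {A : Set} → (ℕ → A) → ℕ → ℕ → Set
PeriodicFrom c N ℓ = ∀ k → N ≤ k → c (k Data.Nat.+ ℓ) ≡ c k
  where import Data.Nat

HasType : ∀ {A : Set} → (ℕ → A) → ℕ → ℕ → Set
HasType c N ℓ = (1 ≤ ℓ) × PeriodicFrom c N ℓ ×
  (∀ N′ ℓ′ → 1 ≤ ℓ′ → PeriodicFrom c N′ ℓ′ → (N ≤ N′) × (ℓ ≤ ℓ′))

alt : ∀ {A : Set} → A → A → ℕ → A
alt a b zero    = a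
alt a b (suc k) = alt b a k

cfSeq : ∀ {A : Set} → A → A → A → ℕ → A
cfSeq a₀ a₁ a₂ zero    = a₀
cfSeq a₀ a₁ a₂ (suc k) = alt a₁ a₂ k

module Submission where

-- Z[X_{n+1}] is built from pairs over Z[X_n].  By induction on n it is a commutative ring, the
-- relative norm p² - X² q² vanishes only at 0 (norms come down to 2, which is not a square), and
-- the sign function sgn makes it an Archimedean ordered ring: the sign of p + X q is read off
-- from the signs of p, q and of its norm.
--
-- For the sequence a₀, a₁, a₂, a₁, a₂, … the convergent matrices satisfy M_{k+2} = A M_k for a
-- fixed A = (α β; γ δ), so for both square roots r = ± X of D = X² the quantity L r k = p_k - r q_k
-- obeys L r (k+2) = μ r · L r k + E r · q_k.  Convergence to X bounds |E X| by a constant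
-- independent of the precision asked for, so E X = 0, i.e. β = D γ and α = δ.  The type (1, 2)
-- excludes a₁ = 0; hence a₂ = 2a₀ and N(α + X a₁) = 1.  Now μ X · μ (-X) = 1 and
-- μ (-X)² - μ X² = 4X α a₁, so α a₁ < 0 would give |μ (-X)| < 1 < |μ X|, which convergence rules
-- out.  Conversely, for a unit ε = p + X q with q ∣ p - 1 and p q > 0 the same identities hold, and
-- then L X k = (μ X)^j L X i decays while L (-X) k - L X k = 2X q_k grows like |μ (-X)|^j along
-- k = 2j + i.

open import Defs
open import Level using (0ℓ)
open import Algebra.Bundles using (CommutativeRing; CommutativeSemiring)
open import Algebra.Structures using (IsCommutativeRing)
import Algebra.Properties.Ring as RingProperties
import Algebra.Solver.Ring.AlmostCommutativeRing as ACR
import Algebra.Solver.Ring as RingSolver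
open import Data.Nat as ℕ using (ℕ; zero; suc)
import Data.Nat.Properties as ℕ
open import Data.Nat.Divisibility using (divides)
open import Data.Nat.Primality using (Prime; prime?; euclidsLemma)
open import Data.Nat.Induction using (<-rec)
open import Data.Nat.DivMod using (_/_; _%_; m≡m%n+[m/n]*n; m%n<n; /-monoˡ-≤; m*n/n≡m)
open import Data.Nat.Tactic.RingSolver using (solve-∀)
open import Data.Integer as ℤ using (ℤ; +_; -[1+_]; 0ℤ; 1ℤ)
import Data.Integer.Properties as ℤ
open import Data.Product using (Σ; ∃; _×_; _,_; proj₁; proj₂)
open import Data.Sum using (_⊎_; inj₁; inj₂; [_,_]′)
open import Data.Maybe using (Maybe; just; nothing)
open import Data.Empty using (⊥-elim)
open import Function using (id)
open import Relation.Nullary using (¬_; yes; no)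
open import Relation.Nullary.Decidable using (from-yes)
open import Relation.Binary.Structures using (IsPreorder)
open import Relation.Binary.PropositionalEquality
  using (_≡_; _≢_; refl; sym; trans; cong; cong₂; subst; subst₂; isEquivalence; resp₂; module ≡-Reasoning)

-- Irrationality of √2

2-prime : Prime 2
2-prime = from-yes (prime? 2)

halve-square-root : ∀ a b → a ℕ.* a ≡ 2 ℕ.* (b ℕ.* b) →
                    ∃ λ a′ → a ≡ a′ ℕ.* 2 × b ℕ.* b ≡ 2 ℕ.* (a′ ℕ.* a′)
halve-square-root a b a²≡2b² with [ id , id ]′ (euclidsLemma a a 2-prime (divides (b ℕ.* b) (trans a²≡2b² (ℕ.*-comm 2 (b ℕ.* b)))))
... | divides a′ refl = a′ , refl , ℕ.*-cancelˡ-≡ _ _ 2 (trans (sym a²≡2b²) (square-double a′))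
  where
  square-double : ∀ x → x ℕ.* 2 ℕ.* (x ℕ.* 2) ≡ 2 ℕ.* (2 ℕ.* (x ℕ.* x))
  square-double = solve-∀

sqrt2-irrational : ∀ a b → a ℕ.* a ≡ 2 ℕ.* (b ℕ.* b) → b ≡ 0
sqrt2-irrational a b = <-rec (λ b → ∀ a → a ℕ.* a ≡ 2 ℕ.* (b ℕ.* b) → b ≡ 0) descent b a
  where
  descent : ∀ b → (∀ {b′} → b′ ℕ.< b → ∀ a → a ℕ.* a ≡ 2 ℕ.* (b′ ℕ.* b′) → b′ ≡ 0) →
            ∀ a → a ℕ.* a ≡ 2 ℕ.* (b ℕ.* b) → b ≡ 0
  descent zero    _  _ _ = refl
  descent (suc b) ih a eq with halve-square-root a (suc b) eq
  ... | a′ , _ , eq′ with halve-square-root (suc b) a′ eq′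
  ... | zero   , () , _
  ... | suc b′ , b≡2b′ , eq″ with ih (subst (suc b′ ℕ.<_) (sym b≡2b′) (ℕ.m<m*n (suc b′) 2 (ℕ.s≤s (ℕ.s≤s ℕ.z≤n)))) a′ eq″
  ... | ()

ℤ-sqrt2-irrational : ∀ u v → u ℤ.* u ≡ + 2 ℤ.* (v ℤ.* v) → v ≡ 0ℤ
ℤ-sqrt2-irrational u v eq = ℤ.∣i∣≡0⇒i≡0 (sqrt2-irrational ℤ.∣ u ∣ ℤ.∣ v ∣ (begin
  ℤ.∣ u ∣ ℕ.* ℤ.∣ u ∣            ≡⟨ ℤ.abs-* u u ⟨
  ℤ.∣ u ℤ.* u ∣                  ≡⟨ cong ℤ.∣_∣ eq ⟩
  ℤ.∣ + 2 ℤ.* (v ℤ.* v) ∣        ≡⟨ ℤ.abs-* (+ 2) (v ℤ.* v) ⟩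
  2 ℕ.* ℤ.∣ v ℤ.* v ∣            ≡⟨ cong (2 ℕ.*_) (ℤ.abs-* v v) ⟩
  2 ℕ.* (ℤ.∣ v ∣ ℕ.* ℤ.∣ v ∣)    ∎))
  where open ≡-Reasoning

-- The ring Z[X_n]

-- D n = X (suc n)², see X-squared.
D : ∀ n → R n
D n = two ⊕ X n

-- The fromℤ laws let the ring solver below work with integer coefficients.
record RingLaws (n : ℕ) : Set where
  field
    isCommutativeRing : IsCommutativeRing (_≡_ {A = R n}) _⊕_ _⊗_ ⊖_ 𝟘 𝟙
    fromℤ-+   : ∀ a b → fromℤ {n} (a ℤ.+ b) ≡ fromℤ a ⊕ fromℤ b
    fromℤ-*   : ∀ a b → fromℤ {n} (a ℤ.* b) ≡ fromℤ a ⊗ fromℤ b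
    fromℤ-neg : ∀ a → fromℤ {n} (ℤ.- a) ≡ ⊖ fromℤ a
    fromℤ-0   : fromℤ {n} 0ℤ ≡ 𝟘
    fromℤ-1   : fromℤ {n} 1ℤ ≡ 𝟙

  commutativeRing : CommutativeRing 0ℓ 0ℓ
  commutativeRing = record { isCommutativeRing = isCommutativeRing }

  open CommutativeRing commutativeRing public
    using ( +-assoc; +-comm; +-identityˡ; +-identityʳ; -‿inverseˡ; -‿inverseʳ
          ; *-assoc; *-comm; *-identityˡ; *-identityʳ; zeroˡ; zeroʳ; distribˡ; distribʳ)
  open RingProperties (CommutativeRing.ring commutativeRing) public
    using (-0#≈0#; -‿involutive; -‿distribˡ-*; -‿distribʳ-*; x∙y⁻¹≈ε⇒x≈y; x≈y⇒x∙y⁻¹≈ε)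

  private
    fromℤ-homomorphism : ℤ.+-*-rawRing ACR.-Raw-AlmostCommutative⟶ ACR.fromCommutativeRing commutativeRing
    fromℤ-homomorphism = record
      { ⟦_⟧ = fromℤ ; +-homo = fromℤ-+ ; *-homo = fromℤ-* ; -‿homo = fromℤ-neg ; 0-homo = fromℤ-0 ; 1-homo = fromℤ-1 }

    fromℤ-≟ : ∀ a b → Maybe (fromℤ {n} a ≡ fromℤ b)
    fromℤ-≟ a b with a ℤ.≟ b
    ... | yes refl = just refl
    ... | no _     = nothing

  open RingSolver ℤ.+-*-rawRing (ACR.fromCommutativeRing commutativeRing) fromℤ-homomorphism fromℤ-≟ public
    using (Polynomial; solve; _:=_; _:+_; _:*_; :-_; _:-_; con)

module _ {n : ℕ} (laws : RingLaws n) where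
  open RingLaws laws

  private
    P : Set
    P = R (suc n)

    D⊗𝟘⊗ : ∀ a → D n ⊗ (𝟘 ⊗ a) ≡ 𝟘
    D⊗𝟘⊗ a = trans (cong (D n ⊗_) (zeroˡ a)) (zeroʳ (D n))

    ⊕-assoc : ∀ (x y z : P) → (x ⊕ y) ⊕ z ≡ x ⊕ (y ⊕ z)
    ⊕-assoc (a , b) (c , d) (e , f) = cong₂ _,_ (+-assoc a c e) (+-assoc b d f)

    ⊕-comm : ∀ (x y : P) → x ⊕ y ≡ y ⊕ x
    ⊕-comm (a , b) (c , d) = cong₂ _,_ (+-comm a c) (+-comm b d)

    ⊕-identityˡ : ∀ (x : P) → 𝟘 ⊕ x ≡ x
    ⊕-identityˡ (a , b) = cong₂ _,_ (+-identityˡ a) (+-identityˡ b)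

    ⊕-identityʳ : ∀ (x : P) → x ⊕ 𝟘 ≡ x
    ⊕-identityʳ (a , b) = cong₂ _,_ (+-identityʳ a) (+-identityʳ b)

    ⊖-inverseˡ : ∀ (x : P) → ⊖ x ⊕ x ≡ 𝟘
    ⊖-inverseˡ (a , b) = cong₂ _,_ (-‿inverseˡ a) (-‿inverseˡ b)

    ⊖-inverseʳ : ∀ (x : P) → x ⊕ ⊖ x ≡ 𝟘
    ⊖-inverseʳ (a , b) = cong₂ _,_ (-‿inverseʳ a) (-‿inverseʳ b)

    ⊗-assoc : ∀ (x y z : P) → (x ⊗ y) ⊗ z ≡ x ⊗ (y ⊗ z)
    ⊗-assoc (a , b) (c , d) (e , f) = cong₂ _,_
      (solve 7 (λ k a b c d e f → (a :* c :+ k :* (b :* d)) :* e :+ k :* ((a :* d :+ b :* c) :* f)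
                               := a :* (c :* e :+ k :* (d :* f)) :+ k :* (b :* (c :* f :+ d :* e))) refl (D n) a b c d e f)
      (solve 7 (λ k a b c d e f → (a :* c :+ k :* (b :* d)) :* f :+ (a :* d :+ b :* c) :* e
                               := a :* (c :* f :+ d :* e) :+ b :* (c :* e :+ k :* (d :* f))) refl (D n) a b c d e f)

    ⊗-comm : ∀ (x y : P) → x ⊗ y ≡ y ⊗ x
    ⊗-comm (a , b) (c , d) = cong₂ _,_
      (cong₂ _⊕_ (*-comm a c) (cong (D n ⊗_) (*-comm b d)))
      (trans (+-comm _ _) (cong₂ _⊕_ (*-comm b c) (*-comm a d)))

    ⊗-identityˡ : ∀ (x : P) → 𝟙 ⊗ x ≡ x
    ⊗-identityˡ (a , b) = cong₂ _,_
      (trans (cong₂ _⊕_ (*-identityˡ a) (D⊗𝟘⊗ b)) (+-identityʳ a))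
      (trans (cong₂ _⊕_ (*-identityˡ b) (zeroˡ a)) (+-identityʳ b))

    ⊗-distribˡ : ∀ (x y z : P) → x ⊗ (y ⊕ z) ≡ x ⊗ y ⊕ x ⊗ z
    ⊗-distribˡ (a , b) (c , d) (e , f) = cong₂ _,_
      (solve 7 (λ k a b c d e f → a :* (c :+ e) :+ k :* (b :* (d :+ f))
                               := (a :* c :+ k :* (b :* d)) :+ (a :* e :+ k :* (b :* f))) refl (D n) a b c d e f)
      (solve 6 (λ a b c d e f → a :* (d :+ f) :+ b :* (c :+ e)
                             := (a :* d :+ b :* c) :+ (a :* f :+ b :* e)) refl a b c d e f)

    isCommutativeRing-suc : IsCommutativeRing (_≡_ {A = P}) _⊕_ _⊗_ ⊖_ 𝟘 𝟙
    isCommutativeRing-suc = record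
      { isRing = record
        { +-isAbelianGroup = record
          { isGroup = record
            { isMonoid = record
              { isSemigroup = record
                { isMagma = record { isEquivalence = isEquivalence ; ∙-cong = cong₂ _⊕_ }
                ; assoc = ⊕-assoc }
              ; identity = ⊕-identityˡ , ⊕-identityʳ }
            ; inverse = ⊖-inverseˡ , ⊖-inverseʳ
            ; ⁻¹-cong = cong ⊖_ }
          ; comm = ⊕-comm }
        ; *-cong = cong₂ _⊗_
        ; *-assoc = ⊗-assoc
        ; *-identity = ⊗-identityˡ , λ x → trans (⊗-comm x 𝟙) (⊗-identityˡ x)
        ; distrib = ⊗-distribˡ , λ x y z → trans (⊗-comm (y ⊕ z) x)
                                             (trans (⊗-distribˡ x y z) (cong₂ _⊕_ (⊗-comm x y) (⊗-comm x z))) }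
      ; *-comm = ⊗-comm }

  ringLaws-suc : RingLaws (suc n)
  ringLaws-suc = record
    { isCommutativeRing = isCommutativeRing-suc
    ; fromℤ-+   = λ a b → cong₂ _,_ (fromℤ-+ a b) (sym (+-identityˡ 𝟘))
    ; fromℤ-*   = λ a b → cong₂ _,_ (trans (fromℤ-* a b) (sym (trans (cong (fromℤ a ⊗ fromℤ b ⊕_) (D⊗𝟘⊗ 𝟘)) (+-identityʳ _))))
                                    (sym (trans (cong₂ _⊕_ (zeroʳ _) (zeroˡ _)) (+-identityˡ 𝟘)))
    ; fromℤ-neg = λ a → cong₂ _,_ (fromℤ-neg a) (sym -0#≈0#)
    ; fromℤ-0   = cong (_, 𝟘) fromℤ-0
    ; fromℤ-1   = cong (_, 𝟘) fromℤ-1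
    }

ringLaws : ∀ n → RingLaws n
ringLaws zero = record
  { isCommutativeRing = ℤ.+-*-isCommutativeRing
  ; fromℤ-+ = λ _ _ → refl ; fromℤ-* = λ _ _ → refl ; fromℤ-neg = λ _ → refl ; fromℤ-0 = refl ; fromℤ-1 = refl }
ringLaws (suc n) = ringLaws-suc (ringLaws n)

module Ring (n : ℕ) where
  open RingLaws (ringLaws n) public
  open import Algebra.Definitions.RawSemiring (CommutativeSemiring.rawSemiring (CommutativeRing.commutativeSemiring commutativeRing)) public
    using () renaming (_^_ to _^ₙ_)
  open import Algebra.Properties.CommutativeSemiring.Exp (CommutativeRing.commutativeSemiring commutativeRing) public
    using (^-distrib-*)

infixr 8 _^_
_^_ : ∀ {n} → R n → ℕ → R n
_^_ {n} = Ring._^ₙ_ n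

module _ {n : ℕ} where
  open Ring n

  ι-⊕ : ∀ (u v : R n) → ι (u ⊕ v) ≡ ι u ⊕ ι v
  ι-⊕ u v = cong (u ⊕ v ,_) (sym (+-identityˡ 𝟘))

  ι-⊖ : ∀ (u : R n) → ι (⊖ u) ≡ ⊖ ι u
  ι-⊖ u = cong (⊖ u ,_) (sym -0#≈0#)

  ι-⊝ : ∀ (u v : R n) → ι (u ⊝ v) ≡ ι u ⊝ ι v
  ι-⊝ u v = trans (ι-⊕ u (⊖ v)) (cong (ι u ⊕_) (ι-⊖ v))

  ι-⊗ : ∀ (u v : R n) → ι (u ⊗ v) ≡ ι u ⊗ ι v
  ι-⊗ u v = sym (cong₂ _,_ (trans (cong (u ⊗ v ⊕_) (trans (cong (D n ⊗_) (zeroˡ 𝟘)) (zeroʳ (D n)))) (+-identityʳ _))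
                           (trans (cong₂ _⊕_ (zeroʳ u) (zeroˡ v)) (+-identityˡ 𝟘)))

X-squared : ∀ n → X (suc n) ⊗ X (suc n) ≡ ι (D n)
X-squared n = cong₂ _,_ (trans (cong₂ _⊕_ (zeroˡ 𝟘) (trans (cong (D n ⊗_) (*-identityˡ 𝟙)) (*-identityʳ (D n)))) (+-identityˡ (D n)))
                        (trans (cong₂ _⊕_ (zeroˡ 𝟙) (zeroʳ 𝟙)) (+-identityˡ 𝟘))
  where open Ring n

⊖X-squared : ∀ n → ⊖ X (suc n) ⊗ ⊖ X (suc n) ≡ ι (D n)
⊖X-squared n = trans (solve 1 (λ x → (:- x) :* (:- x) := x :* x) refl (X (suc n))) (X-squared n)
  where open Ring (suc n)

ι⊕X⊗ι : ∀ {n} (u v : R n) → ι u ⊕ X (suc n) ⊗ ι v ≡ (u , v)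
ι⊕X⊗ι {n} u v = cong₂ _,_
  (trans (cong (u ⊕_) (trans (cong₂ _⊕_ (zeroˡ v) (trans (cong (D n ⊗_) (zeroʳ 𝟙)) (zeroʳ (D n)))) (+-identityˡ 𝟘))) (+-identityʳ u))
  (trans (+-identityˡ _) (trans (cong₂ _⊕_ (zeroˡ 𝟘) (*-identityˡ v)) (+-identityˡ v)))
  where open Ring n

-- Norms

module _ {n : ℕ} where
  open Ring n

  Nrel-⊗ : ∀ (x y : R (suc n)) → Nrel (x ⊗ y) ≡ Nrel x ⊗ Nrel y
  Nrel-⊗ (a , b) (c , d) = solve 5 (λ k a b c d →
      (a :* c :+ k :* (b :* d)) :* (a :* c :+ k :* (b :* d)) :- k :* ((a :* d :+ b :* c) :* (a :* d :+ b :* c))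
    := (a :* a :- k :* (b :* b)) :* (c :* c :- k :* (d :* d))) refl (D n) a b c d

  Nrel-ι : ∀ (a : R n) → Nrel (ι a) ≡ a ⊗ a
  Nrel-ι a = trans (cong (a ⊗ a ⊝_) (trans (cong (D n ⊗_) (zeroˡ 𝟘)) (zeroʳ (D n))))
                   (trans (cong (a ⊗ a ⊕_) -0#≈0#) (+-identityʳ (a ⊗ a)))

  Nrel-𝟘b : ∀ (b : R n) → Nrel (𝟘 , b) ≡ ⊖ (D n ⊗ (b ⊗ b))
  Nrel-𝟘b b = trans (cong (_⊝ D n ⊗ (b ⊗ b)) (zeroˡ 𝟘)) (+-identityˡ _)

-- The solver reads `con z` as `fromℤ z`, which equals 𝟙 or 𝟘 only propositionally; identities that
-- need the constants are therefore proved for `fromℤ` and transported along fromℤ-1 and fromℤ-0.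
module _ (n : ℕ) where
  open Ring n

  Nrel-D : Nrel (D (suc n)) ≡ two ⊝ X n
  Nrel-D = subst₂ (λ o z → ((o ⊕ o) ⊕ z) ⊗ ((o ⊕ o) ⊕ z) ⊝ ((o ⊕ o) ⊕ X n) ⊗ (((z ⊕ z) ⊕ o) ⊗ ((z ⊕ z) ⊕ o)) ≡ (o ⊕ o) ⊝ X n)
    fromℤ-1 fromℤ-0
    (solve 1 (λ x → ((con 1ℤ :+ con 1ℤ) :+ con 0ℤ) :* ((con 1ℤ :+ con 1ℤ) :+ con 0ℤ)
                      :- ((con 1ℤ :+ con 1ℤ) :+ x) :* (((con 0ℤ :+ con 0ℤ) :+ con 1ℤ) :* ((con 0ℤ :+ con 0ℤ) :+ con 1ℤ))
                    := (con 1ℤ :+ con 1ℤ) :- x) refl (X n))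

  Nrel-two⊝X : Nrel (two ⊝ X (suc n)) ≡ two ⊝ X n
  Nrel-two⊝X = subst₂ (λ o z → ((o ⊕ o) ⊕ ⊖ z) ⊗ ((o ⊕ o) ⊕ ⊖ z) ⊝ ((o ⊕ o) ⊕ X n) ⊗ (((z ⊕ z) ⊕ ⊖ o) ⊗ ((z ⊕ z) ⊕ ⊖ o)) ≡ (o ⊕ o) ⊝ X n)
    fromℤ-1 fromℤ-0
    (solve 1 (λ x → ((con 1ℤ :+ con 1ℤ) :- con 0ℤ) :* ((con 1ℤ :+ con 1ℤ) :- con 0ℤ)
                      :- ((con 1ℤ :+ con 1ℤ) :+ x) :* (((con 0ℤ :+ con 0ℤ) :- con 1ℤ) :* ((con 0ℤ :+ con 0ℤ) :- con 1ℤ))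
                    := (con 1ℤ :+ con 1ℤ) :- x) refl (X n))

norm : ∀ {n} → R n → ℤ
norm {zero}  a = a
norm {suc n} x = norm (Nrel x)

norm-⊗ : ∀ {n} (x y : R n) → norm (x ⊗ y) ≡ norm x ℤ.* norm y
norm-⊗ {zero}  x y = refl
norm-⊗ {suc n} x y = trans (cong norm (Nrel-⊗ x y)) (norm-⊗ (Nrel x) (Nrel y))

norm-two±X : ∀ n → norm (D n) ≡ + 2 × norm (two ⊝ X n) ≡ + 2
norm-two±X zero    = refl , refl
norm-two±X (suc n) = trans (cong norm (Nrel-D n)) (proj₂ (norm-two±X n)) , trans (cong norm (Nrel-two⊝X n)) (proj₂ (norm-two±X n))

norm-𝟘 : ∀ {n} → norm {n} 𝟘 ≡ 0ℤ
norm-𝟘 {zero}  = refl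
norm-𝟘 {suc n} = trans (cong norm (Nrel-ι {n} 𝟘)) (trans (norm-⊗ {n} 𝟘 𝟘) (cong (ℤ._* norm {n} 𝟘) (norm-𝟘 {n})))

mutual
  norm≡0⇒≡𝟘 : ∀ {n} (x : R n) → norm x ≡ 0ℤ → x ≡ 𝟘
  norm≡0⇒≡𝟘 {zero}  x eq = eq
  norm≡0⇒≡𝟘 {suc n} x eq = Nrel≡𝟘⇒≡𝟘 x (norm≡0⇒≡𝟘 (Nrel x) eq)

  -- D n is not a square in the fraction field: its norm 2 is not a square in ℚ.
  Nrel≡𝟘⇒≡𝟘 : ∀ {n} (x : R (suc n)) → Nrel x ≡ 𝟘 → x ≡ 𝟘
  Nrel≡𝟘⇒≡𝟘 {n} (a , b) eq = cong₂ _,_ a≡𝟘 b≡𝟘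
    where
    open Ring n
    a²≡Db² : a ⊗ a ≡ D n ⊗ (b ⊗ b)
    a²≡Db² = x∙y⁻¹≈ε⇒x≈y _ _ eq
    b≡𝟘 : b ≡ 𝟘
    b≡𝟘 = norm≡0⇒≡𝟘 b (ℤ-sqrt2-irrational (norm a) (norm b) (begin
      norm a ℤ.* norm a           ≡⟨ norm-⊗ a a ⟨
      norm (a ⊗ a)                ≡⟨ cong norm a²≡Db² ⟩
      norm (D n ⊗ (b ⊗ b))        ≡⟨ norm-⊗ (D n) (b ⊗ b) ⟩
      norm (D n) ℤ.* norm (b ⊗ b) ≡⟨ cong₂ ℤ._*_ (proj₁ (norm-two±X n)) (norm-⊗ b b) ⟩
      + 2 ℤ.* (norm b ℤ.* norm b) ∎))
      where open ≡-Reasoning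
    a≡𝟘 : a ≡ 𝟘
    a≡𝟘 = norm≡0⇒≡𝟘 a ([ id , id ]′ (ℤ.i*j≡0⇒i≡0∨j≡0 (norm a) (begin
      norm a ℤ.* norm a      ≡⟨ norm-⊗ a a ⟨
      norm (a ⊗ a)           ≡⟨ cong norm a²≡Db² ⟩
      norm (D n ⊗ (b ⊗ b))   ≡⟨ cong (λ t → norm (D n ⊗ (t ⊗ t))) b≡𝟘 ⟩
      norm (D n ⊗ (𝟘 ⊗ 𝟘))   ≡⟨ cong norm (trans (cong (D n ⊗_) (zeroˡ 𝟘)) (zeroʳ (D n))) ⟩
      norm {n} 𝟘             ≡⟨ norm-𝟘 {n} ⟩
      0ℤ                     ∎)))
      where open ≡-Reasoning

-- The order of Z[X_n]

negSgn : Sgn → Sgn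
negSgn neg = pos
negSgn zer = zer
negSgn pos = neg

infixl 7 _*ˢ_
_*ˢ_ : Sgn → Sgn → Sgn
zer *ˢ _ = zer
pos *ˢ t = t
neg *ˢ t = negSgn t

-- The sign of p + X q once the sign r of its relative norm p² - X² q² is known.
bySgn : Sgn → Sgn → Sgn → Sgn
bySgn pos s t = s
bySgn neg s t = t
bySgn zer s t = zer

negSgn-involutive : ∀ s → negSgn (negSgn s) ≡ s
negSgn-involutive neg = refl
negSgn-involutive zer = refl
negSgn-involutive pos = refl

*ˢ-zeroʳ : ∀ s → s *ˢ zer ≡ zer
*ˢ-zeroʳ neg = refl
*ˢ-zeroʳ zer = refl
*ˢ-zeroʳ pos = refl

combine-negSgn : ∀ s t r → combine (negSgn s) (negSgn t) r ≡ negSgn (combine s t r)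
combine-negSgn neg neg r   = refl
combine-negSgn neg zer r   = refl
combine-negSgn neg pos neg = refl
combine-negSgn neg pos zer = refl
combine-negSgn neg pos pos = refl
combine-negSgn zer neg r   = refl
combine-negSgn zer zer r   = refl
combine-negSgn zer pos r   = refl
combine-negSgn pos neg neg = refl
combine-negSgn pos neg zer = refl
combine-negSgn pos neg pos = refl
combine-negSgn pos zer r   = refl
combine-negSgn pos pos r   = refl

combine≡zer : ∀ s t r → combine s t r ≡ zer → (s ≡ zer × t ≡ zer) ⊎ r ≡ zer
combine≡zer neg neg r   ()
combine≡zer neg zer r   ()
combine≡zer neg pos neg ()
combine≡zer neg pos zer _ = inj₂ refl
combine≡zer neg pos pos ()
combine≡zer zer neg r   ()
combine≡zer zer zer r   _ = inj₁ (refl , refl)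
combine≡zer zer pos r   ()
combine≡zer pos neg neg ()
combine≡zer pos neg zer _ = inj₂ refl
combine≡zer pos neg pos ()
combine≡zer pos zer r   ()
combine≡zer pos pos r   ()

-- The hypotheses are what the norm of (a , b) satisfies when b = 0, when a = 0, and in general.
combine≡bySgn : ∀ s t r → (t ≡ zer → r ≡ s *ˢ s) → (s ≡ zer → t ≢ zer → r ≡ neg) → (r ≡ zer → t ≡ zer) →
                combine s t r ≡ bySgn r s t
combine≡bySgn neg zer r   b≡0 _ _ rewrite b≡0 refl = refl
combine≡bySgn zer zer r   b≡0 _ _ rewrite b≡0 refl = refl
combine≡bySgn pos zer r   b≡0 _ _ rewrite b≡0 refl = refl
combine≡bySgn zer neg r   _ a≡0 _ rewrite a≡0 refl (λ ()) = refl
combine≡bySgn zer pos r   _ a≡0 _ rewrite a≡0 refl (λ ()) = refl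
combine≡bySgn neg neg neg _ _ _ = refl
combine≡bySgn neg neg pos _ _ _ = refl
combine≡bySgn neg neg zer _ _ N≡0 with () ← N≡0 refl
combine≡bySgn pos pos neg _ _ _ = refl
combine≡bySgn pos pos pos _ _ _ = refl
combine≡bySgn pos pos zer _ _ N≡0 with () ← N≡0 refl
combine≡bySgn neg pos neg _ _ _ = refl
combine≡bySgn neg pos zer _ _ _ = refl
combine≡bySgn neg pos pos _ _ _ = refl
combine≡bySgn pos neg neg _ _ _ = refl
combine≡bySgn pos neg zer _ _ _ = refl
combine≡bySgn pos neg pos _ _ _ = refl

sgn-𝟘 : ∀ n → sgn {n} 𝟘 ≡ zer
sgn-𝟘 zero = refl
sgn-𝟘 (suc n) rewrite sgn-𝟘 n = refl

sgn-ι : ∀ {n} (a : R n) → sgn (ι a) ≡ sgn a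
sgn-ι {n} a rewrite sgn-𝟘 n with sgn a
... | neg = refl
... | zer = refl
... | pos = refl

sgn-fromℤ : ∀ n (z : ℤ) → sgn {n} (fromℤ z) ≡ sgnℤ z
sgn-fromℤ zero    z = refl
sgn-fromℤ (suc n) z = trans (sgn-ι (fromℤ {n} z)) (sgn-fromℤ n z)

Pos-𝟙 : ∀ n → Pos (𝟙 {n})
Pos-𝟙 zero    = refl
Pos-𝟙 (suc n) = trans (sgn-ι (𝟙 {n})) (Pos-𝟙 n)

*ˢ≡zer : ∀ s t → s *ˢ t ≡ zer → s ≡ zer ⊎ t ≡ zer
*ˢ≡zer zer t _ = inj₁ refl
*ˢ≡zer pos t e = inj₂ e
*ˢ≡zer neg t e = inj₂ (trans (sym (negSgn-involutive t)) (cong negSgn e))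

NonNeg : ∀ {n} → R n → Set
NonNeg x = Pos x ⊎ sgn x ≡ zer

infix 4 _≤ᴿ_
_≤ᴿ_ : ∀ {n} → R n → R n → Set
x ≤ᴿ y = NonNeg (y ⊝ x)

record SignLaws (n : ℕ) : Set where
  field
    sgn-⊖       : ∀ (x : R n) → sgn (⊖ x) ≡ negSgn (sgn x)
    sgn-⊗       : ∀ (x y : R n) → sgn (x ⊗ y) ≡ sgn x *ˢ sgn y
    sgn≡zer⇒≡𝟘 : ∀ (x : R n) → sgn x ≡ zer → x ≡ 𝟘
    Pos-⊕       : ∀ (x y : R n) → Pos x → Pos y → Pos (x ⊕ y)

module Order {n : ℕ} (laws : SignLaws n) where
  open SignLaws laws public
  open Ring n

  Pos⇒≢zer : ∀ {x : R n} → Pos x → sgn x ≢ zer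
  Pos⇒≢zer p e with () ← trans (sym p) e

  Pos⇒≢neg : ∀ {x : R n} → Pos x → sgn x ≢ neg
  Pos⇒≢neg p e with () ← trans (sym p) e

  NonNeg⇒≢neg : ∀ {x : R n} → NonNeg x → sgn x ≢ neg
  NonNeg⇒≢neg (inj₁ p) = Pos⇒≢neg p
  NonNeg⇒≢neg (inj₂ z) e with () ← trans (sym z) e

  ≡𝟘⇒sgn≡zer : ∀ {x : R n} → x ≡ 𝟘 → sgn x ≡ zer
  ≡𝟘⇒sgn≡zer refl = sgn-𝟘 n

  neg⇒Pos-⊖ : ∀ {x : R n} → sgn x ≡ neg → Pos (⊖ x)
  neg⇒Pos-⊖ {x} e = trans (sgn-⊖ x) (cong negSgn e)

  Pos⇒neg-⊖ : ∀ {x : R n} → Pos x → sgn (⊖ x) ≡ neg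
  Pos⇒neg-⊖ {x} e = trans (sgn-⊖ x) (cong negSgn e)

  Pos-⊖⇒neg : ∀ {x : R n} → Pos (⊖ x) → sgn x ≡ neg
  Pos-⊖⇒neg {x} e = trans (sym (negSgn-involutive (sgn x))) (cong negSgn (trans (sym (sgn-⊖ x)) e))

  ¬Pos⇒NonNeg-⊖ : ∀ {x : R n} → ¬ Pos x → NonNeg (⊖ x)
  ¬Pos⇒NonNeg-⊖ {x} h with sgn x in e
  ... | neg = inj₁ (neg⇒Pos-⊖ e)
  ... | zer = inj₂ (trans (sgn-⊖ x) (cong negSgn e))
  ... | pos = ⊥-elim (h refl)

  NonNeg-𝟙 : NonNeg (𝟙 {n})
  NonNeg-𝟙 = inj₁ (Pos-𝟙 n)

  ≢𝟘∧¬Pos⇒neg : ∀ {x : R n} → x ≢ 𝟘 → ¬ Pos x → sgn x ≡ neg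
  ≢𝟘∧¬Pos⇒neg {x} x≢𝟘 ¬p with sgn x in e
  ... | neg = refl
  ... | zer = ⊥-elim (x≢𝟘 (sgn≡zer⇒≡𝟘 x e))
  ... | pos = ⊥-elim (¬p refl)

  Pos-stable : ∀ (x : R n) → ¬ ¬ Pos x → Pos x
  Pos-stable x ¬¬p with sgn x
  ... | pos = refl
  ... | zer = ⊥-elim (¬¬p λ ())
  ... | neg = ⊥-elim (¬¬p λ ())

  Pos-⊕-NonNeg : ∀ {x y : R n} → Pos x → NonNeg y → Pos (x ⊕ y)
  Pos-⊕-NonNeg {x} {y} px (inj₁ py) = Pos-⊕ x y px py
  Pos-⊕-NonNeg {x} {y} px (inj₂ zy) rewrite sgn≡zer⇒≡𝟘 y zy | +-identityʳ x = px

  NonNeg-⊕ : ∀ {x y : R n} → NonNeg x → NonNeg y → NonNeg (x ⊕ y)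
  NonNeg-⊕ (inj₁ px) ny = inj₁ (Pos-⊕-NonNeg px ny)
  NonNeg-⊕ {x} {y} (inj₂ zx) ny rewrite sgn≡zer⇒≡𝟘 x zx | +-identityˡ y = ny

  Pos-⊗ : ∀ {x y : R n} → Pos x → Pos y → Pos (x ⊗ y)
  Pos-⊗ {x} {y} px py rewrite sgn-⊗ x y | px | py = refl

  NonNeg-⊗ : ∀ {x y : R n} → NonNeg x → NonNeg y → NonNeg (x ⊗ y)
  NonNeg-⊗ {x} {y} nx ny rewrite sgn-⊗ x y with sgn x | sgn y | nx | ny
  ... | pos | pos | _ | _ = inj₁ refl
  ... | pos | zer | _ | _ = inj₂ refl
  ... | zer | _   | _ | _ = inj₂ refl
  ... | neg | _   | inj₁ () | _
  ... | neg | _   | inj₂ () | _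
  ... | pos | neg | _ | inj₁ ()
  ... | pos | neg | _ | inj₂ ()

  square-NonNeg : ∀ (x : R n) → NonNeg (x ⊗ x)
  square-NonNeg x rewrite sgn-⊗ x x with sgn x
  ... | neg = inj₁ refl
  ... | zer = inj₂ refl
  ... | pos = inj₁ refl

  square-Pos : ∀ (x : R n) → sgn x ≢ zer → Pos (x ⊗ x)
  square-Pos x h rewrite sgn-⊗ x x with sgn x
  ... | neg = refl
  ... | zer = ⊥-elim (h refl)
  ... | pos = refl

  <-trans : ∀ {x y z : R n} → x <ᴿ y → y <ᴿ z → x <ᴿ z
  <-trans {x} {y} {z} p q = subst Pos (solve 3 (λ x y z → (z :- y) :+ (y :- x) := z :- x) refl x y z) (Pos-⊕ _ _ q p)

  <-irrefl : ∀ {x : R n} → ¬ (x <ᴿ x)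
  <-irrefl {x} p = Pos⇒≢zer p (≡𝟘⇒sgn≡zer (-‿inverseʳ x))

  <⇒sgn-⊝≡neg : ∀ {x y : R n} → x <ᴿ y → sgn (x ⊝ y) ≡ neg
  <⇒sgn-⊝≡neg {x} {y} p = trans (cong sgn (solve 2 (λ x y → x :- y := :- (y :- x)) refl x y)) (Pos⇒neg-⊖ p)

  sgn-⊝≡neg⇒< : ∀ {x y : R n} → sgn (x ⊝ y) ≡ neg → x <ᴿ y
  sgn-⊝≡neg⇒< {x} {y} e = subst Pos (solve 2 (λ x y → :- (x :- y) := y :- x) refl x y) (neg⇒Pos-⊖ e)

  <-asym : ∀ {x y : R n} → x <ᴿ y → ¬ (y <ᴿ x)
  <-asym p q = Pos⇒≢neg q (<⇒sgn-⊝≡neg p)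

  ≮⇒≥ : ∀ {x y : R n} → ¬ (x <ᴿ y) → y ≤ᴿ x
  ≮⇒≥ {x} {y} h = subst NonNeg (solve 2 (λ x y → :- (y :- x) := x :- y) refl x y) (¬Pos⇒NonNeg-⊖ h)

  ≤⇒≯ : ∀ {x y : R n} → x ≤ᴿ y → ¬ (y <ᴿ x)
  ≤⇒≯ le lt = NonNeg⇒≢neg le (<⇒sgn-⊝≡neg lt)

  <⇒≤ : ∀ {x y : R n} → x <ᴿ y → x ≤ᴿ y
  <⇒≤ = inj₁

  <-≤-trans : ∀ {x y z : R n} → x <ᴿ y → y ≤ᴿ z → x <ᴿ z
  <-≤-trans {x} {y} {z} p q = subst Pos (solve 3 (λ x y z → (y :- x) :+ (z :- y) := z :- x) refl x y z) (Pos-⊕-NonNeg p q)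

  ≤-<-trans : ∀ {x y z : R n} → x ≤ᴿ y → y <ᴿ z → x <ᴿ z
  ≤-<-trans {x} {y} {z} p q = subst Pos (solve 3 (λ x y z → (z :- y) :+ (y :- x) := z :- x) refl x y z) (Pos-⊕-NonNeg q p)

  ≤-trans : ∀ {x y z : R n} → x ≤ᴿ y → y ≤ᴿ z → x ≤ᴿ z
  ≤-trans {x} {y} {z} p q = subst NonNeg (solve 3 (λ x y z → (z :- y) :+ (y :- x) := z :- x) refl x y z) (NonNeg-⊕ q p)

  ≤-refl : ∀ {x : R n} → x ≤ᴿ x
  ≤-refl {x} = inj₂ (≡𝟘⇒sgn≡zer (-‿inverseʳ x))

  <-cmp : ∀ (x y : R n) → x <ᴿ y ⊎ y ≤ᴿ x
  <-cmp x y with sgn (y ⊝ x) in e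
  ... | pos = inj₁ refl
  ... | zer = inj₂ (≮⇒≥ λ p → Pos⇒≢zer p e)
  ... | neg = inj₂ (≮⇒≥ λ p → Pos⇒≢neg p e)

  x⊝𝟘≡x : ∀ (x : R n) → x ⊝ 𝟘 ≡ x
  x⊝𝟘≡x x = trans (cong (x ⊕_) -0#≈0#) (+-identityʳ x)

  Pos⇒0< : ∀ {x : R n} → Pos x → 𝟘 <ᴿ x
  Pos⇒0< {x} = subst Pos (sym (x⊝𝟘≡x x))

  0<⇒Pos : ∀ {x : R n} → 𝟘 <ᴿ x → Pos x
  0<⇒Pos {x} = subst Pos (x⊝𝟘≡x x)

  NonNeg⇒0≤ : ∀ {x : R n} → NonNeg x → 𝟘 ≤ᴿ x
  NonNeg⇒0≤ {x} = subst NonNeg (sym (x⊝𝟘≡x x))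

  *-monoˡ-< : ∀ {w x y : R n} → Pos w → x <ᴿ y → w ⊗ x <ᴿ w ⊗ y
  *-monoˡ-< {w} {x} {y} pw p = subst Pos (solve 3 (λ w x y → w :* (y :- x) := w :* y :- w :* x) refl w x y) (Pos-⊗ pw p)

  *-monoˡ-≤ : ∀ {w x y : R n} → NonNeg w → x ≤ᴿ y → w ⊗ x ≤ᴿ w ⊗ y
  *-monoˡ-≤ {w} {x} {y} pw p = subst NonNeg (solve 3 (λ w x y → w :* (y :- x) := w :* y :- w :* x) refl w x y) (NonNeg-⊗ pw p)

  *-cancelˡ-< : ∀ {w x y : R n} → Pos w → w ⊗ x <ᴿ w ⊗ y → x <ᴿ y
  *-cancelˡ-< {w} {x} {y} pw p = begin
    pos *ˢ sgn (y ⊝ x)   ≡⟨ cong (_*ˢ sgn (y ⊝ x)) pw ⟨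
    sgn w *ˢ sgn (y ⊝ x) ≡⟨ sgn-⊗ w (y ⊝ x) ⟨
    sgn (w ⊗ (y ⊝ x))    ≡⟨ cong sgn (solve 3 (λ w x y → w :* (y :- x) := w :* y :- w :* x) refl w x y) ⟩
    sgn (w ⊗ y ⊝ w ⊗ x)  ≡⟨ p ⟩
    pos                  ∎
    where open ≡-Reasoning

  +-mono-<-≤ : ∀ {x y u v : R n} → x <ᴿ y → u ≤ᴿ v → x ⊕ u <ᴿ y ⊕ v
  +-mono-<-≤ {x} {y} {u} {v} p q = subst Pos (solve 4 (λ x y u v → (y :- x) :+ (v :- u) := (y :+ v) :- (x :+ u)) refl x y u v) (Pos-⊕-NonNeg p q)

  +-mono-≤ : ∀ {x y u v : R n} → x ≤ᴿ y → u ≤ᴿ v → x ⊕ u ≤ᴿ y ⊕ v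
  +-mono-≤ {x} {y} {u} {v} p q = subst NonNeg (solve 4 (λ x y u v → (y :- x) :+ (v :- u) := (y :+ v) :- (x :+ u)) refl x y u v) (NonNeg-⊕ p q)

  +-cancelʳ-< : ∀ {x y : R n} z → x ⊕ z <ᴿ y ⊕ z → x <ᴿ y
  +-cancelʳ-< {x} {y} z = subst Pos (solve 3 (λ x y z → (y :+ z) :- (x :+ z) := y :- x) refl x y z)

  *-mono-≤ : ∀ {u′ u v′ v : R n} → NonNeg u′ → u′ ≤ᴿ u → NonNeg v′ → v′ ≤ᴿ v → u′ ⊗ v′ ≤ᴿ u ⊗ v
  *-mono-≤ {u′} {u} {v′} {v} nu′ p nv′ q =
    subst NonNeg (solve 4 (λ u′ u v′ v → v :* (u :- u′) :+ u′ :* (v :- v′) := u :* v :- u′ :* v′) refl u′ u v′ v)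
      (NonNeg-⊕ (NonNeg-⊗ nv p) (NonNeg-⊗ nu′ q))
    where
    nv : NonNeg v
    nv = subst NonNeg (solve 2 (λ v′ v → (v :- v′) :+ v′ := v) refl v′ v) (NonNeg-⊕ q nv′)

  *-mono-< : ∀ {u′ u v′ v : R n} → NonNeg u′ → u′ <ᴿ u → NonNeg v′ → v′ <ᴿ v → u′ ⊗ v′ <ᴿ u ⊗ v
  *-mono-< {u′} {u} {v′} {v} nu′ p nv′ q =
    subst Pos (solve 4 (λ u′ u v′ v → v :* (u :- u′) :+ u′ :* (v :- v′) := u :* v :- u′ :* v′) refl u′ u v′ v)
      (Pos-⊕-NonNeg (Pos-⊗ pv p) (NonNeg-⊗ nu′ (inj₁ q)))
    where
    pv : Pos v
    pv = subst Pos (solve 2 (λ v′ v → (v :- v′) :+ v′ := v) refl v′ v) (Pos-⊕-NonNeg q nv′)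

  private
    Pos-⊕-dominant : ∀ {u v : R n} → Pos u → v ⊗ v <ᴿ u ⊗ u → Pos (u ⊕ v)
    Pos-⊕-dominant {u} {v} pu v²<u² with sgn v in ev
    ... | pos = Pos-⊕ u v pu ev
    ... | zer = Pos-⊕-NonNeg pu (inj₂ ev)
    ... | neg = Pos-stable (u ⊕ v) λ ¬p → ≤⇒≯ (u²≤v² ¬p) v²<u²
      where
      u²≤v² : ¬ Pos (u ⊕ v) → u ⊗ u ≤ᴿ v ⊗ v
      u²≤v² ¬p = subst NonNeg (solve 2 (λ u v → (:- (u :+ v)) :* (u :- v) := v :* v :- u :* u) refl u v)
                   (NonNeg-⊗ (¬Pos⇒NonNeg-⊖ ¬p) (inj₁ (Pos-⊕ u (⊖ v) pu (neg⇒Pos-⊖ ev))))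

  sgn-⊕-dominantˡ : ∀ (u v : R n) → v ⊗ v <ᴿ u ⊗ u → sgn (u ⊕ v) ≡ sgn u
  sgn-⊕-dominantˡ u v v²<u² with sgn u in eu
  ... | pos = Pos-⊕-dominant eu v²<u²
  ... | zer = ⊥-elim (Pos⇒≢zer (0<⇒Pos (≤-<-trans (NonNeg⇒0≤ (square-NonNeg v)) v²<u²))
                                (trans (sgn-⊗ u u) (cong (λ s → s *ˢ s) eu)))
  ... | neg = Pos-⊖⇒neg (subst Pos (solve 2 (λ u v → (:- u) :+ (:- v) := :- (u :+ v)) refl u v)
                 (Pos-⊕-dominant (neg⇒Pos-⊖ eu) (subst₂ _<ᴿ_ (neg² v) (neg² u) v²<u²)))
    where
    neg² : ∀ x → x ⊗ x ≡ ⊖ x ⊗ ⊖ x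
    neg² = solve 1 (λ x → x :* x := (:- x) :* (:- x)) refl

  sgn-⊕-dominantʳ : ∀ (u v : R n) → u ⊗ u <ᴿ v ⊗ v → sgn (u ⊕ v) ≡ sgn v
  sgn-⊕-dominantʳ u v u²<v² = trans (cong sgn (+-comm u v)) (sgn-⊕-dominantˡ v u u²<v²)

  ≤-isPreorder : IsPreorder _≡_ (_≤ᴿ_ {n})
  ≤-isPreorder = record { isEquivalence = isEquivalence ; reflexive = λ { refl → ≤-refl } ; trans = ≤-trans }

  module ≤-Reasoning where
    open import Relation.Binary.Reasoning.Base.Triple
      ≤-isPreorder <-asym <-trans (resp₂ _<ᴿ_) <⇒≤ <-≤-trans ≤-<-trans public
      hiding (step-≈; step-≈˘; step-≈-⟩; step-≈-⟨)

  ⊗≡𝟘⇒≡𝟘 : ∀ {x y : R n} → x ≢ 𝟘 → x ⊗ y ≡ 𝟘 → y ≡ 𝟘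
  ⊗≡𝟘⇒≡𝟘 {x} {y} x≢𝟘 xy≡𝟘 with *ˢ≡zer (sgn x) (sgn y) (trans (sym (sgn-⊗ x y)) (≡𝟘⇒sgn≡zer xy≡𝟘))
  ... | inj₁ x≡𝟘 = ⊥-elim (x≢𝟘 (sgn≡zer⇒≡𝟘 x x≡𝟘))
  ... | inj₂ y≡𝟘 = sgn≡zer⇒≡𝟘 y y≡𝟘

X-NonNeg : ∀ n → NonNeg (X n)
X-NonNeg zero = inj₂ refl
X-NonNeg (suc n) rewrite sgn-𝟘 n | Pos-𝟙 n = inj₁ refl

module _ {n : ℕ} (laws : SignLaws n) where
  open Ring n
  open Order laws

  D-Pos : Pos (D n)
  D-Pos = Pos-⊕-NonNeg (Pos-⊕ 𝟙 𝟙 (Pos-𝟙 n) (Pos-𝟙 n)) (X-NonNeg n)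

  sgn-by-Nrel : ∀ (a b : R n) → sgn {suc n} (a , b) ≡ bySgn (sgn (Nrel (a , b))) (sgn a) (sgn b)
  sgn-by-Nrel a b = combine≡bySgn (sgn a) (sgn b) (sgn (Nrel (a , b))) b≡𝟘⇒ a≡𝟘⇒ Nrel≡𝟘⇒
    where
    b≡𝟘⇒ : sgn b ≡ zer → sgn (Nrel (a , b)) ≡ sgn a *ˢ sgn a
    b≡𝟘⇒ e rewrite sgn≡zer⇒≡𝟘 b e = trans (cong sgn (Nrel-ι a)) (sgn-⊗ a a)
    a≡𝟘⇒ : sgn a ≡ zer → sgn b ≢ zer → sgn (Nrel (a , b)) ≡ neg
    a≡𝟘⇒ e b≢𝟘 rewrite sgn≡zer⇒≡𝟘 a e = trans (cong sgn (Nrel-𝟘b b)) (Pos⇒neg-⊖ (Pos-⊗ D-Pos (square-Pos b b≢𝟘)))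
    Nrel≡𝟘⇒ : sgn (Nrel (a , b)) ≡ zer → sgn b ≡ zer
    Nrel≡𝟘⇒ e = trans (cong (λ x → sgn (proj₂ x)) (Nrel≡𝟘⇒≡𝟘 (a , b) (sgn≡zer⇒≡𝟘 _ e))) (sgn-𝟘 n)

  private
    P : Set
    P = R (suc n)

    sgn-⊖-suc : ∀ (x : P) → sgn (⊖ x) ≡ negSgn (sgn x)
    sgn-⊖-suc (a , b) rewrite sgn-⊖ a | sgn-⊖ b
      | solve 3 (λ k a b → (:- a) :* (:- a) :- k :* ((:- b) :* (:- b)) := a :* a :- k :* (b :* b)) refl (D n) a b
      = combine-negSgn (sgn a) (sgn b) _

    sgn≡zer⇒≡𝟘-suc : ∀ (x : P) → sgn x ≡ zer → x ≡ 𝟘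
    sgn≡zer⇒≡𝟘-suc (a , b) e with combine≡zer (sgn a) (sgn b) (sgn (Nrel (a , b))) e
    ... | inj₁ (ea , eb) = cong₂ _,_ (sgn≡zer⇒≡𝟘 a ea) (sgn≡zer⇒≡𝟘 b eb)
    ... | inj₂ er = Nrel≡𝟘⇒≡𝟘 (a , b) (sgn≡zer⇒≡𝟘 _ er)

    NonNeg-D-sq : ∀ x → NonNeg (D n ⊗ (x ⊗ x))
    NonNeg-D-sq x = NonNeg-⊗ (inj₁ D-Pos) (square-NonNeg x)

    sq-⊗ : ∀ x y → (x ⊗ x) ⊗ (y ⊗ y) ≡ (x ⊗ y) ⊗ (x ⊗ y)
    sq-⊗ = solve 2 (λ x y → (x :* x) :* (y :* y) := (x :* y) :* (x :* y)) refl

    D-sq-⊗ : ∀ x y → (D n ⊗ (x ⊗ x)) ⊗ (y ⊗ y) ≡ D n ⊗ ((x ⊗ y) ⊗ (x ⊗ y))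
    D-sq-⊗ = solve 3 (λ k x y → (k :* (x :* x)) :* (y :* y) := k :* ((x :* y) :* (x :* y))) refl (D n)

    sq-D-⊗ : ∀ x y → (x ⊗ x) ⊗ (D n ⊗ (y ⊗ y)) ≡ D n ⊗ ((x ⊗ y) ⊗ (x ⊗ y))
    sq-D-⊗ = solve 3 (λ k x y → (x :* x) :* (k :* (y :* y)) := k :* ((x :* y) :* (x :* y))) refl (D n)

    D-sq-⊗-D : ∀ x y → (D n ⊗ (x ⊗ x)) ⊗ (D n ⊗ (y ⊗ y)) ≡ (D n ⊗ (x ⊗ y)) ⊗ (D n ⊗ (x ⊗ y))
    D-sq-⊗-D = solve 3 (λ k x y → (k :* (x :* x)) :* (k :* (y :* y)) := (k :* (x :* y)) :* (k :* (x :* y))) refl (D n)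

    -- Multiplying the norm inequalities D b² ⋚ a² and D d² ⋚ c² shows which summand of
    -- (a , b) ⊗ (c , d) = (ac + D bd , ad + bc) dominates.
    bySgn-⊗ : ∀ a b c d sx sy → sgn (Nrel (a , b)) ≡ sx → sgn (Nrel (c , d)) ≡ sy →
              bySgn (sx *ˢ sy) (sgn (a ⊗ c ⊕ D n ⊗ (b ⊗ d))) (sgn (a ⊗ d ⊕ b ⊗ c)) ≡
              bySgn sx (sgn a) (sgn b) *ˢ bySgn sy (sgn c) (sgn d)
    bySgn-⊗ a b c d zer sy  _ _ = refl
    bySgn-⊗ a b c d pos zer _ _ = sym (*ˢ-zeroʳ (sgn a))
    bySgn-⊗ a b c d neg zer _ _ = sym (*ˢ-zeroʳ (sgn b))
    bySgn-⊗ a b c d pos pos ex ey = trans (sgn-⊕-dominantˡ (a ⊗ c) (D n ⊗ (b ⊗ d))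
      (subst₂ _<ᴿ_ (D-sq-⊗-D b d) (sq-⊗ a c) (*-mono-< (NonNeg-D-sq b) ex (NonNeg-D-sq d) ey))) (sgn-⊗ a c)
    bySgn-⊗ a b c d pos neg ex ey = trans (sgn-⊕-dominantˡ (a ⊗ d) (b ⊗ c) (*-cancelˡ-< D-Pos
      (subst₂ _<ᴿ_ (D-sq-⊗ b c) (sq-D-⊗ a d) (*-mono-< (NonNeg-D-sq b) ex (square-NonNeg c) (sgn-⊝≡neg⇒< ey))))) (sgn-⊗ a d)
    bySgn-⊗ a b c d neg pos ex ey = trans (sgn-⊕-dominantʳ (a ⊗ d) (b ⊗ c) (*-cancelˡ-< D-Pos
      (subst₂ _<ᴿ_ (sq-D-⊗ a d) (D-sq-⊗ b c) (*-mono-< (square-NonNeg a) (sgn-⊝≡neg⇒< ex) (NonNeg-D-sq d) ey)))) (sgn-⊗ b c)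
    bySgn-⊗ a b c d neg neg ex ey = trans (sgn-⊕-dominantʳ (a ⊗ c) (D n ⊗ (b ⊗ d))
      (subst₂ _<ᴿ_ (sq-⊗ a c) (D-sq-⊗-D b d) (*-mono-< (square-NonNeg a) (sgn-⊝≡neg⇒< ex) (square-NonNeg c) (sgn-⊝≡neg⇒< ey))))
      (trans (sgn-⊗ (D n) (b ⊗ d)) (trans (cong (_*ˢ sgn (b ⊗ d)) D-Pos) (sgn-⊗ b d)))

    sgn-⊗-suc : ∀ (x y : P) → sgn (x ⊗ y) ≡ sgn x *ˢ sgn y
    sgn-⊗-suc (a , b) (c , d) = begin
      sgn (u , v)                                    ≡⟨ sgn-by-Nrel u v ⟩
      bySgn (sgn (Nrel (u , v))) (sgn u) (sgn v)     ≡⟨ cong (λ s → bySgn s (sgn u) (sgn v)) sgn-Nrel ⟩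
      bySgn (sgn Nx *ˢ sgn Ny) (sgn u) (sgn v)       ≡⟨ bySgn-⊗ a b c d (sgn Nx) (sgn Ny) refl refl ⟩
      bySgn (sgn Nx) (sgn a) (sgn b) *ˢ bySgn (sgn Ny) (sgn c) (sgn d) ≡⟨ cong₂ _*ˢ_ (sgn-by-Nrel a b) (sgn-by-Nrel c d) ⟨
      sgn (a , b) *ˢ sgn (c , d)                     ∎
      where
      open ≡-Reasoning
      u : R n
      u = a ⊗ c ⊕ D n ⊗ (b ⊗ d)
      v : R n
      v = a ⊗ d ⊕ b ⊗ c
      Nx : R n
      Nx = Nrel (a , b)
      Ny : R n
      Ny = Nrel (c , d)
      sgn-Nrel : sgn (Nrel (u , v)) ≡ sgn Nx *ˢ sgn Ny
      sgn-Nrel = trans (cong sgn (Nrel-⊗ (a , b) (c , d))) (sgn-⊗ Nx Ny)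

    Pos-shift : ∀ {t c d : R n} → Pos t → Pos {suc n} (c , d) → Pos {suc n} (t ⊕ c , d)
    Pos-shift {t} {c} {d} pt pcd = by-Nrel (sgn (Nrel (c , d))) refl (trans (sym (sgn-by-Nrel c d)) pcd)
      where
      by-Nrel : ∀ r → sgn (Nrel (c , d)) ≡ r → bySgn r (sgn c) (sgn d) ≡ pos → Pos {suc n} (t ⊕ c , d)
      by-Nrel zer _  ()
      by-Nrel pos eN pc = trans (sgn-by-Nrel (t ⊕ c) d)
                                (trans (cong (λ r → bySgn r (sgn (t ⊕ c)) (sgn d)) N′-Pos) (Pos-⊕ t c pt pc))
        where
        N′-Pos : Pos (Nrel (t ⊕ c , d))
        N′-Pos = subst Pos (solve 4 (λ k t c d → (c :* c :- k :* (d :* d)) :+ t :* (t :+ (c :+ c))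
                                               := (t :+ c) :* (t :+ c) :- k :* (d :* d)) refl (D n) t c d)
                   (Pos-⊕ _ _ eN (Pos-⊗ pt (Pos-⊕ t (c ⊕ c) pt (Pos-⊕ c c pc pc))))
      by-Nrel neg eN pd = trans (sgn-by-Nrel (t ⊕ c) d) (by-Nrel′ (sgn (Nrel (t ⊕ c , d))) refl (sgn (t ⊕ c)) refl)
        where
        shifted²<Dd² : ¬ Pos (t ⊕ c) → (t ⊕ c) ⊗ (t ⊕ c) <ᴿ D n ⊗ (d ⊗ d)
        shifted²<Dd² ¬p = <-trans {y = c ⊗ c}
          (subst Pos (solve 2 (λ t c → t :* ((t :+ (:- (t :+ c))) :+ (:- (t :+ c))) := c :* c :- (t :+ c) :* (t :+ c)) refl t c)
             (Pos-⊗ pt (Pos-⊕-NonNeg (Pos-⊕-NonNeg pt (¬Pos⇒NonNeg-⊖ ¬p)) (¬Pos⇒NonNeg-⊖ ¬p))))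
          (sgn-⊝≡neg⇒< eN)
        by-Nrel′ : ∀ r → sgn (Nrel (t ⊕ c , d)) ≡ r → ∀ s → sgn (t ⊕ c) ≡ s → bySgn r s (sgn d) ≡ pos
        by-Nrel′ zer eN′ _ _ = ⊥-elim (Pos⇒≢zer pd (trans (cong (λ x → sgn (proj₂ x)) (Nrel≡𝟘⇒≡𝟘 _ (sgn≡zer⇒≡𝟘 _ eN′))) (sgn-𝟘 n)))
        by-Nrel′ neg _   _   _  = pd
        by-Nrel′ pos _   pos _  = refl
        by-Nrel′ pos eN′ zer es = ⊥-elim (<-asym (shifted²<Dd² λ p → Pos⇒≢zer p es) eN′)
        by-Nrel′ pos eN′ neg es = ⊥-elim (<-asym (shifted²<Dd² λ p → Pos⇒≢neg p es) eN′)

  -- Multiplying by ± the conjugate (a , -b) clears the X-part.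
  rationalise : ∀ (x : R (suc n)) → Pos x → Σ (R (suc n)) λ w → Σ (R n) λ M → Pos w × Pos M × x ⊗ w ≡ ι M
  rationalise (a , b) px = by-Nrel (sgn (Nrel (a , b))) refl
    where
    x̄ : R (suc n)
    x̄ = a , ⊖ b
    xx̄≡N : (a , b) ⊗ x̄ ≡ ι (Nrel (a , b))
    xx̄≡N = cong₂ _,_ (solve 3 (λ k a b → a :* a :+ k :* (b :* (:- b)) := a :* a :- k :* (b :* b)) refl (D n) a b)
                      (trans (solve 2 (λ a b → a :* (:- b) :+ b :* a := con 0ℤ) refl a b) fromℤ-0)
    sgn-x̄ : sgn x̄ ≡ sgn (Nrel (a , b))
    sgn-x̄ = begin
      pos *ˢ sgn x̄          ≡⟨ cong (_*ˢ sgn x̄) px ⟨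
      sgn (a , b) *ˢ sgn x̄  ≡⟨ sgn-⊗-suc (a , b) x̄ ⟨
      sgn ((a , b) ⊗ x̄)     ≡⟨ cong sgn xx̄≡N ⟩
      sgn (ι (Nrel (a , b))) ≡⟨ sgn-ι (Nrel (a , b)) ⟩
      sgn (Nrel (a , b))    ∎
      where open ≡-Reasoning
    by-Nrel : ∀ r → sgn (Nrel (a , b)) ≡ r → Σ (R (suc n)) λ w → Σ (R n) λ M → Pos w × Pos M × (a , b) ⊗ w ≡ ι M
    by-Nrel pos e = x̄ , Nrel (a , b) , trans sgn-x̄ e , e , xx̄≡N
    by-Nrel neg e = ⊖ x̄ , ⊖ Nrel (a , b) , trans (sgn-⊖-suc x̄) (cong negSgn (trans sgn-x̄ e)) , neg⇒Pos-⊖ e ,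
                    trans (sym (Ring.-‿distribʳ-* (suc n) (a , b) x̄)) (trans (cong ⊖_ xx̄≡N) (cong (⊖ Nrel (a , b) ,_) -0#≈0#))
    by-Nrel zer e with () ← trans (sym px) (trans (cong sgn (Nrel≡𝟘⇒≡𝟘 (a , b) (sgn≡zer⇒≡𝟘 _ e))) (sgn-𝟘 (suc n)))

  private
    -- Multiplying by the w of rationalise x moves x into R n, where Pos-shift applies.
    Pos-⊕-suc : ∀ (x y : R (suc n)) → Pos x → Pos y → Pos (x ⊕ y)
    Pos-⊕-suc x y px py with rationalise x px
    ... | w , M , pw , pM , xw≡M = begin
      pos *ˢ sgn (x ⊕ y)   ≡⟨ cong (_*ˢ sgn (x ⊕ y)) pw ⟨
      sgn w *ˢ sgn (x ⊕ y) ≡⟨ sgn-⊗-suc w (x ⊕ y) ⟨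
      sgn (w ⊗ (x ⊕ y))    ≡⟨ cong sgn w[x+y]≡ ⟩
      sgn {suc n} (M ⊕ p (w ⊗ y) , q (w ⊗ y)) ≡⟨ Pos-shift pM Pos-wy ⟩
      pos                  ∎
      where
      open ≡-Reasoning
      module S = Ring (suc n)
      Pos-wy : Pos (w ⊗ y)
      Pos-wy = trans (sgn-⊗-suc w y) (cong₂ _*ˢ_ pw py)
      w[x+y]≡ : w ⊗ (x ⊕ y) ≡ (M ⊕ p (w ⊗ y) , q (w ⊗ y))
      w[x+y]≡ = trans (S.distribˡ w x y) (trans (cong (_⊕ w ⊗ y) (trans (S.*-comm w x) xw≡M))
                                                (cong (M ⊕ p (w ⊗ y) ,_) (+-identityˡ _)))

  signLaws-suc : SignLaws (suc n)
  signLaws-suc = record { sgn-⊖ = sgn-⊖-suc ; sgn-⊗ = sgn-⊗-suc ; sgn≡zer⇒≡𝟘 = sgn≡zer⇒≡𝟘-suc ; Pos-⊕ = Pos-⊕-suc }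

signLaws-ℤ : SignLaws 0
signLaws-ℤ = record { sgn-⊖ = sgn-⊖ ; sgn-⊗ = sgn-⊗ ; sgn≡zer⇒≡𝟘 = sgn≡zer⇒≡𝟘 ; Pos-⊕ = Pos-⊕ }
  where
  sgn-⊖ : ∀ (x : ℤ) → sgn (⊖ x) ≡ negSgn (sgn x)
  sgn-⊖ (+ zero)  = refl
  sgn-⊖ (+ suc _) = refl
  sgn-⊖ -[1+ _ ]  = refl
  sgn-⊗ : ∀ (x y : ℤ) → sgn (x ⊗ y) ≡ sgn x *ˢ sgn y
  sgn-⊗ (+ zero)  y         = refl
  sgn-⊗ x         (+ zero)  rewrite ℤ.*-zeroʳ x = sym (*ˢ-zeroʳ (sgn x))
  sgn-⊗ (+ suc _) (+ suc _) = refl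
  sgn-⊗ (+ suc _) -[1+ _ ]  = refl
  sgn-⊗ -[1+ _ ]  (+ suc _) = refl
  sgn-⊗ -[1+ _ ]  -[1+ _ ]  = refl
  sgn≡zer⇒≡𝟘 : ∀ (x : ℤ) → sgn x ≡ zer → x ≡ 𝟘
  sgn≡zer⇒≡𝟘 (+ zero) _ = refl
  Pos-⊕ : ∀ (x y : ℤ) → Pos x → Pos y → Pos (x ⊕ y)
  Pos-⊕ (+ suc _) (+ suc _) _ _ = refl

signLaws : ∀ n → SignLaws n
signLaws zero    = signLaws-ℤ
signLaws (suc n) = signLaws-suc (signLaws n)

-- The Archimedean property

fromℕ : ∀ {n} → ℕ → R n
fromℕ j = fromℤ (+ j)

Archimedean : ℕ → Set
Archimedean n = ∀ (e c : R n) → Pos e → ∃ λ M → c <ᴿ fromℕ (suc M) ⊗ e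

archimedean-ℤ : Archimedean 0
archimedean-ℤ (+ suc d) (+ k)    _ = k , cong sgnℤ (trans
  (solve 2 (λ k d → (con 1ℤ :+ k) :* (con 1ℤ :+ d) :- k := con 1ℤ :+ (d :+ k :* d)) refl (+ k) (+ d))
  (cong (λ z → 1ℤ ℤ.+ (+ d ℤ.+ z)) (sym (ℤ.pos-* k d))))
  where open Ring 0
archimedean-ℤ (+ suc d) -[1+ k ] _ = 0 , refl

module Embeddings (n : ℕ) where
  open Ring n
  open Order (signLaws n)

  fromℕ-suc : ∀ j → fromℕ {n} (suc j) ≡ 𝟙 ⊕ fromℕ j
  fromℕ-suc j = trans (fromℤ-+ 1ℤ (+ j)) (cong (_⊕ fromℕ j) fromℤ-1)

  fromℕ-NonNeg : ∀ j → NonNeg (fromℕ {n} j)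
  fromℕ-NonNeg zero    = inj₂ (sgn-fromℤ n 0ℤ)
  fromℕ-NonNeg (suc j) = inj₁ (sgn-fromℤ n (+ suc j))

  𝟙≤fromℕ-suc : ∀ j → 𝟙 ≤ᴿ fromℕ {n} (suc j)
  𝟙≤fromℕ-suc j = subst NonNeg (trans (solve 2 (λ o f → f := (o :+ f) :- o) refl 𝟙 (fromℕ j)) (cong (_⊝ 𝟙) (sym (fromℕ-suc j))))
                    (fromℕ-NonNeg j)

  fromℕ-mono-≤ : ∀ {a b} → a ℕ.≤ b → fromℕ {n} a ≤ᴿ fromℕ b
  fromℕ-mono-≤ {a} a≤b with ℕ.m≤n⇒∃[o]m+o≡n a≤b
  ... | t , refl = subst NonNeg (trans (solve 2 (λ x y → y := (x :+ y) :- x) refl (fromℕ a) (fromℕ t))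
                                       (cong (_⊝ fromℕ a) (sym (fromℤ-+ (+ a) (+ t)))))
                         (fromℕ-NonNeg t)

  ι-mono-< : ∀ {u v : R n} → u <ᴿ v → ι u <ᴿ ι v
  ι-mono-< {u} {v} u<v = trans (cong sgn (sym (ι-⊝ v u))) (trans (sgn-ι (v ⊝ u)) u<v)

  below-fromℕ : Archimedean n → ∀ (c : R n) → ∃ λ N → c <ᴿ fromℕ N
  below-fromℕ arch c with arch 𝟙 c (Pos-𝟙 n)
  ... | M , c<M = suc M , subst (c <ᴿ_) (*-identityʳ _) c<M

𝟙<X : ∀ n → 𝟙 <ᴿ X (suc n)
𝟙<X n = begin
  sgn {suc n} (a , b)                    ≡⟨ sgn-by-Nrel (signLaws n) a b ⟩
  bySgn (sgn (Nrel (a , b))) (sgn a) (sgn b) ≡⟨ cong (λ r → bySgn r (sgn a) (sgn b)) (trans (cong sgn Nrel≡) (<⇒sgn-⊝≡neg 𝟙<D)) ⟩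
  sgn b                                  ≡⟨ cong sgn (trans (cong (𝟙 ⊕_) -0#≈0#) (+-identityʳ 𝟙)) ⟩
  sgn (𝟙 {n})                            ≡⟨ Pos-𝟙 n ⟩
  pos                                    ∎
  where
  open ≡-Reasoning
  open Ring n
  open Order (signLaws n)
  a : R n
  a = 𝟘 ⊕ ⊖ 𝟙
  b : R n
  b = 𝟙 ⊕ ⊖ 𝟘
  Nrel≡ : Nrel (a , b) ≡ 𝟙 ⊝ D n
  Nrel≡ = subst₂ (λ o z → (z ⊕ ⊖ o) ⊗ (z ⊕ ⊖ o) ⊝ ((o ⊕ o) ⊕ X n) ⊗ ((o ⊕ ⊖ z) ⊗ (o ⊕ ⊖ z)) ≡ o ⊝ ((o ⊕ o) ⊕ X n))
            fromℤ-1 fromℤ-0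
            (solve 1 (λ x → (con 0ℤ :- con 1ℤ) :* (con 0ℤ :- con 1ℤ) :- ((con 1ℤ :+ con 1ℤ) :+ x) :* ((con 1ℤ :- con 0ℤ) :* (con 1ℤ :- con 0ℤ))
                          := con 1ℤ :- ((con 1ℤ :+ con 1ℤ) :+ x)) refl (X n))
  𝟙<D : 𝟙 <ᴿ D n
  𝟙<D = subst Pos (solve 2 (λ o x → o :+ x := ((o :+ o) :+ x) :- o) refl 𝟙 (X n)) (Pos-⊕-NonNeg (Pos-𝟙 n) (X-NonNeg n))

X-Pos : ∀ n → Pos (X (suc n))
X-Pos n = Order.0<⇒Pos (signLaws (suc n)) (Order.<-trans (signLaws (suc n)) (Order.Pos⇒0< (signLaws (suc n)) (Pos-𝟙 (suc n))) (𝟙<X n))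

module _ {n : ℕ} (arch : Archimedean n) where
  open Ring n
  open Order (signLaws n)
  open Embeddings n
  private
    module S = Ring (suc n)
    module O = Order (signLaws (suc n))

  below-fromℕ-suc : ∀ (x : R (suc n)) → ∃ λ N → x <ᴿ fromℕ N
  below-fromℕ-suc (a , b) with below-fromℕ arch a | below-fromℕ arch (D n ⊗ (b ⊗ b))
  ... | A , a<A | B , Db²<B = A ℕ.+ B ℕ.+ 1 , goal
    where
    u : R n
    u = fromℕ (A ℕ.+ B ℕ.+ 1) ⊝ a
    u≡ : u ≡ (fromℕ A ⊝ a) ⊕ (fromℕ B ⊕ 𝟙)
    u≡ = trans (cong (_⊝ a) (trans (fromℤ-+ (+ A ℤ.+ + B) 1ℤ) (cong₂ _⊕_ (fromℤ-+ (+ A) (+ B)) fromℤ-1)))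
               (solve 4 (λ A B o a → ((A :+ B) :+ o) :- a := (A :- a) :+ (B :+ o)) refl (fromℕ A) (fromℕ B) 𝟙 a)
    Pos-u : Pos u
    Pos-u = subst Pos (sym u≡) (Pos-⊕-NonNeg a<A (NonNeg-⊕ (fromℕ-NonNeg B) NonNeg-𝟙))
    𝟙<u : 𝟙 <ᴿ u
    𝟙<u = subst Pos (sym (trans (cong (_⊝ 𝟙) u≡) (solve 3 (λ p B o → (p :+ (B :+ o)) :- o := p :+ B) refl _ _ 𝟙)))
                (Pos-⊕-NonNeg a<A (fromℕ-NonNeg B))
    B<u : fromℕ B <ᴿ u
    B<u = subst Pos (sym (trans (cong (_⊝ fromℕ B) u≡) (solve 3 (λ p B o → (p :+ (B :+ o)) :- B := p :+ o) refl _ _ 𝟙)))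
                (Pos-⊕ _ _ a<A (Pos-𝟙 n))
    u<u² : u <ᴿ u ⊗ u
    u<u² = subst (_<ᴿ u ⊗ u) (*-identityʳ u) (*-monoˡ-< Pos-u 𝟙<u)
    Nrel-Pos : Pos (Nrel (u , 𝟘 ⊕ ⊖ b))
    Nrel-Pos = subst (λ z → Pos (u ⊗ u ⊝ D n ⊗ z))
                 (sym (trans (cong (λ z → z ⊗ z) (+-identityˡ (⊖ b))) (solve 1 (λ b → (:- b) :* (:- b) := b :* b) refl b)))
                 (<-trans Db²<B (<-trans B<u u<u²))
    goal : (a , b) <ᴿ fromℕ (A ℕ.+ B ℕ.+ 1)
    goal = trans (sgn-by-Nrel (signLaws n) u (𝟘 ⊕ ⊖ b)) (trans (cong (λ r → bySgn r (sgn u) (sgn (𝟘 ⊕ ⊖ b))) Nrel-Pos) Pos-u)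

  private
    below-rationalised : ∀ {e c w : R (suc n)} {M : R n} {B K : ℕ} → Pos w → e ⊗ w ≡ ι M →
                         c ⊗ w <ᴿ fromℕ B → fromℕ B <ᴿ fromℕ (suc K) ⊗ M → c <ᴿ fromℕ (suc K) ⊗ e
    below-rationalised {e} {c} {w} {M} {B} {K} pw ew≡ιM cw<B B<KM =
      O.*-cancelˡ-< pw (subst₂ _<ᴿ_ (S.*-comm c w) (S.*-comm _ w) (O.<-trans cw<B (subst (fromℕ B <ᴿ_) ιKM≡ (ι-mono-< B<KM))))
      where
      ιKM≡ : ι (fromℕ (suc K) ⊗ M) ≡ (fromℕ (suc K) ⊗ e) ⊗ w
      ιKM≡ = trans (ι-⊗ (fromℕ (suc K)) M) (trans (cong (fromℕ (suc K) ⊗_) (sym ew≡ιM)) (sym (S.*-assoc _ e w)))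

  -- Rationalising e to a positive element M of R n reduces the claim to the Archimedean property of R n.
  archimedean-suc : Archimedean (suc n)
  archimedean-suc e c pe =
    let w , M , pw , pM , ew≡ιM = rationalise (signLaws n) e pe
        B , cw<B = below-fromℕ-suc (c ⊗ w)
        K , B<KM = arch M (fromℕ B) pM
    in K , below-rationalised pw ew≡ιM cw<B B<KM

archimedean : ∀ n → Archimedean n
archimedean zero    = archimedean-ℤ
archimedean (suc n) = archimedean-suc (archimedean n)

-- Absolute values and powers

module Absolute (n : ℕ) where
  open Ring n
  open Order (signLaws n)

  abs-≢neg : ∀ (x : R n) → sgn x ≢ neg → abs x ≡ x
  abs-≢neg x h with sgn x
  ... | neg = ⊥-elim (h refl)
  ... | zer = refl
  ... | pos = refl

  abs-neg : ∀ (x : R n) → sgn x ≡ neg → abs x ≡ ⊖ x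
  abs-neg x h with sgn x
  abs-neg x refl | neg = refl

  abs-NonNeg : ∀ (x : R n) → NonNeg x → abs x ≡ x
  abs-NonNeg x h = abs-≢neg x (NonNeg⇒≢neg h)

  NonNeg-abs : ∀ (x : R n) → NonNeg (abs x)
  NonNeg-abs x with sgn x in e
  ... | neg = inj₁ (neg⇒Pos-⊖ e)
  ... | zer = inj₂ e
  ... | pos = inj₁ e

  Pos-abs : ∀ (x : R n) → x ≢ 𝟘 → Pos (abs x)
  Pos-abs x x≢𝟘 with sgn x in e
  ... | neg = neg⇒Pos-⊖ e
  ... | zer = ⊥-elim (x≢𝟘 (sgn≡zer⇒≡𝟘 x e))
  ... | pos = e

  abs-𝟘 : abs (𝟘 {n}) ≡ 𝟘
  abs-𝟘 = abs-NonNeg 𝟘 (inj₂ (sgn-𝟘 n))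

  abs-⊖ : ∀ (x : R n) → abs (⊖ x) ≡ abs x
  abs-⊖ x with sgn x in e
  ... | neg = abs-NonNeg (⊖ x) (inj₁ (neg⇒Pos-⊖ e))
  ... | zer rewrite sgn≡zer⇒≡𝟘 x e = trans (cong abs -0#≈0#) abs-𝟘
  ... | pos = trans (abs-neg (⊖ x) (Pos⇒neg-⊖ e)) (-‿involutive x)

  x≤abs : ∀ (x : R n) → x ≤ᴿ abs x
  x≤abs x with sgn x in e
  ... | neg = subst NonNeg (solve 1 (λ x → :- x :+ :- x := :- x :- x) refl x)
                (NonNeg-⊕ (inj₁ (neg⇒Pos-⊖ e)) (inj₁ (neg⇒Pos-⊖ e)))
  ... | zer = ≤-refl
  ... | pos = ≤-refl

  ⊖x≤abs : ∀ (x : R n) → ⊖ x ≤ᴿ abs x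
  ⊖x≤abs x = subst (⊖ x ≤ᴿ_) (abs-⊖ x) (x≤abs (⊖ x))

  abs-⊗ : ∀ (x y : R n) → abs (x ⊗ y) ≡ abs x ⊗ abs y
  abs-⊗ x y with sgn x in ex | sgn y in ey
  ... | zer | _   rewrite sgn≡zer⇒≡𝟘 x ex = trans (cong abs (zeroˡ y)) (trans abs-𝟘 (sym (zeroˡ _)))
  ... | pos | zer rewrite sgn≡zer⇒≡𝟘 y ey = trans (cong abs (zeroʳ x)) (trans abs-𝟘 (sym (zeroʳ _)))
  ... | neg | zer rewrite sgn≡zer⇒≡𝟘 y ey = trans (cong abs (zeroʳ x)) (trans abs-𝟘 (sym (zeroʳ _)))
  ... | pos | pos = abs-NonNeg (x ⊗ y) (inj₁ (Pos-⊗ ex ey))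
  ... | neg | neg = trans (abs-NonNeg (x ⊗ y) (inj₁ (trans (sgn-⊗ x y) (cong₂ _*ˢ_ ex ey))))
                          (solve 2 (λ x y → x :* y := (:- x) :* (:- y)) refl x y)
  ... | pos | neg = trans (abs-neg (x ⊗ y) (trans (sgn-⊗ x y) (cong₂ _*ˢ_ ex ey))) (-‿distribʳ-* x y)
  ... | neg | pos = trans (abs-neg (x ⊗ y) (trans (sgn-⊗ x y) (cong₂ _*ˢ_ ex ey))) (-‿distribˡ-* x y)

  abs-triangle : ∀ (x y : R n) → abs (x ⊕ y) ≤ᴿ abs x ⊕ abs y
  abs-triangle x y with sgn (x ⊕ y)
  ... | neg = subst (_≤ᴿ abs x ⊕ abs y) (solve 2 (λ x y → (:- x) :+ (:- y) := :- (x :+ y)) refl x y)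
                (+-mono-≤ (⊖x≤abs x) (⊖x≤abs y))
  ... | zer = +-mono-≤ (x≤abs x) (x≤abs y)
  ... | pos = +-mono-≤ (x≤abs x) (x≤abs y)

  abs-square : ∀ (x : R n) → abs x ⊗ abs x ≡ x ⊗ x
  abs-square x = trans (sym (abs-⊗ x x)) (abs-NonNeg (x ⊗ x) (square-NonNeg x))

  abs-^ : ∀ (x : R n) j → abs (x ^ j) ≡ abs x ^ j
  abs-^ x zero    = abs-NonNeg 𝟙 NonNeg-𝟙
  abs-^ x (suc j) = trans (abs-⊗ x (x ^ j)) (cong (abs x ⊗_) (abs-^ x j))

  abs-unit : ∀ {a b : R n} → a ⊗ b ≡ 𝟙 → abs a ⊗ abs b ≡ 𝟙
  abs-unit {a} {b} ab≡𝟙 = trans (sym (abs-⊗ a b)) (trans (cong abs ab≡𝟙) (abs-NonNeg 𝟙 NonNeg-𝟙))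

  unit-split : ∀ {a b : R n} → a ⊗ b ≡ 𝟙 → a ⊗ a <ᴿ b ⊗ b → abs a <ᴿ 𝟙 × 𝟙 <ᴿ abs b
  unit-split {a} {b} ab≡𝟙 a²<b² = a<𝟙 , 𝟙<b
    where
    |a||b|≡𝟙 : abs a ⊗ abs b ≡ 𝟙
    |a||b|≡𝟙 = abs-unit ab≡𝟙
    a<b : abs a <ᴿ abs b
    a<b with <-cmp (abs a) (abs b)
    ... | inj₁ a<b = a<b
    ... | inj₂ b≤a = ⊥-elim (≤⇒≯ (*-mono-≤ (NonNeg-abs b) b≤a (NonNeg-abs b) b≤a)
                                  (subst₂ _<ᴿ_ (sym (abs-square a)) (sym (abs-square b)) a²<b²))
    𝟙<b : 𝟙 <ᴿ abs b
    𝟙<b with <-cmp 𝟙 (abs b)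
    ... | inj₁ 𝟙<b = 𝟙<b
    ... | inj₂ b≤𝟙 = ⊥-elim (<-irrefl (subst (_<ᴿ 𝟙) |a||b|≡𝟙
            (≤-<-trans (subst (abs a ⊗ abs b ≤ᴿ_) (*-identityʳ (abs a)) (*-monoˡ-≤ (NonNeg-abs a) b≤𝟙)) (<-≤-trans a<b b≤𝟙))))
    a<𝟙 : abs a <ᴿ 𝟙
    a<𝟙 with <-cmp (abs a) 𝟙
    ... | inj₁ a<𝟙 = a<𝟙
    ... | inj₂ 𝟙≤a = ⊥-elim (<-irrefl (subst (𝟙 <ᴿ_) |a||b|≡𝟙
            (<-≤-trans (≤-<-trans 𝟙≤a a<b) (subst (_≤ᴿ abs a ⊗ abs b) (*-identityˡ (abs b)) (*-mono-≤ NonNeg-𝟙 𝟙≤a (NonNeg-abs b) ≤-refl)))))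

  ≡𝟘⊎Pos-abs : ∀ (x : R n) → x ≡ 𝟘 ⊎ Pos (abs x)
  ≡𝟘⊎Pos-abs x with sgn x in e
  ... | neg = inj₂ (neg⇒Pos-⊖ e)
  ... | zer = inj₁ (sgn≡zer⇒≡𝟘 x e)
  ... | pos = inj₂ e

module Powers (n : ℕ) where
  open Ring n
  open Order (signLaws n)
  open Embeddings n

  NonNeg-^ : ∀ {e : R n} → NonNeg e → ∀ j → NonNeg (e ^ j)
  NonNeg-^ h zero    = NonNeg-𝟙
  NonNeg-^ h (suc j) = NonNeg-⊗ h (NonNeg-^ h j)

  𝟙≤^ : ∀ {e : R n} → 𝟙 ≤ᴿ e → ∀ j → 𝟙 ≤ᴿ e ^ j
  𝟙≤^ h zero    = ≤-refl
  𝟙≤^ {e} h (suc j) = subst (_≤ᴿ e ⊗ e ^ j) (*-identityˡ 𝟙) (*-mono-≤ NonNeg-𝟙 h NonNeg-𝟙 (𝟙≤^ h j))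

  ^≤𝟙 : ∀ {e : R n} → NonNeg e → e ≤ᴿ 𝟙 → ∀ j → e ^ j ≤ᴿ 𝟙
  ^≤𝟙 h h′ zero    = ≤-refl
  ^≤𝟙 {e} h h′ (suc j) = subst (e ⊗ e ^ j ≤ᴿ_) (*-identityˡ 𝟙) (*-mono-≤ h h′ (NonNeg-^ h j) (^≤𝟙 h h′ j))

  𝟙^ : ∀ j → 𝟙 ^ j ≡ 𝟙 {n}
  𝟙^ zero    = refl
  𝟙^ (suc j) = trans (*-identityˡ _) (𝟙^ j)

  bernoulli : ∀ {e : R n} → 𝟙 ≤ᴿ e → ∀ j → fromℕ j ⊗ (e ⊝ 𝟙) ≤ᴿ e ^ j
  bernoulli {e} 𝟙≤e zero    = subst (_≤ᴿ 𝟙) (sym (trans (cong (_⊗ (e ⊝ 𝟙)) fromℤ-0) (zeroˡ _))) (NonNeg⇒0≤ NonNeg-𝟙)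
  bernoulli {e} 𝟙≤e (suc j) = begin
    fromℕ (suc j) ⊗ (e ⊝ 𝟙)                 ≡⟨ cong (_⊗ (e ⊝ 𝟙)) (fromℕ-suc j) ⟩
    (𝟙 ⊕ fromℕ j) ⊗ (e ⊝ 𝟙)                 ≡⟨ trans (distribʳ _ 𝟙 _) (cong (_⊕ fromℕ j ⊗ (e ⊝ 𝟙)) (*-identityˡ _)) ⟩
    (e ⊝ 𝟙) ⊕ fromℕ j ⊗ (e ⊝ 𝟙)             ≤⟨ +-mono-≤ (subst (_≤ᴿ (e ⊝ 𝟙) ⊗ e ^ j) (*-identityʳ _)
                                                               (*-monoˡ-≤ 𝟙≤e (𝟙≤^ 𝟙≤e j)))
                                                    (bernoulli 𝟙≤e j) ⟩
    (e ⊝ 𝟙) ⊗ e ^ j ⊕ e ^ j                 ≡⟨ cong ((e ⊝ 𝟙) ⊗ e ^ j ⊕_) (*-identityˡ _) ⟨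
    (e ⊝ 𝟙) ⊗ e ^ j ⊕ 𝟙 ⊗ e ^ j             ≡⟨ solve 3 (λ e w o → (e :- o) :* w :+ o :* w := e :* w) refl e (e ^ j) 𝟙 ⟩
    e ^ suc j                               ∎
    where open ≤-Reasoning

  ^-unbounded : ∀ {e : R n} → 𝟙 <ᴿ e → ∀ (A B : R n) → Pos B → ∃ λ J → ∀ j → J ℕ.≤ j → A <ᴿ e ^ j ⊗ B
  ^-unbounded {e} 𝟙<e A B pB =
    let N , A<NB = archimedean n B A pB
        J , N<J[e-1] = archimedean n (e ⊝ 𝟙) (fromℕ (suc N)) 𝟙<e
    in suc J , λ j J<j → <-trans A<NB (subst₂ _<ᴿ_ (*-comm B _) (*-comm B _)
                           (*-monoˡ-< pB (<-≤-trans N<J[e-1] (≤-trans (subst₂ _≤ᴿ_ (*-comm _ _) (*-comm _ _)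
                              (*-monoˡ-≤ (inj₁ 𝟙<e) (fromℕ-mono-≤ J<j))) (bernoulli (<⇒≤ 𝟙<e) j)))))

-- Continued fractions of period two

mat-cong : ∀ {A : Set} {a b c d a′ b′ c′ d′ : A} → a ≡ a′ → b ≡ b′ → c ≡ c′ → d ≡ d′ → mat a b c d ≡ mat a′ b′ c′ d′
mat-cong refl refl refl refl = refl

·-assoc : ∀ {n} (A B C : Mat (R n)) → (A · B) · C ≡ A · (B · C)
·-assoc {n} (mat a b c d) (mat e f g h) (mat i j k l) = mat-cong
  (solve 12 (λ a b c d e f g h i j k l → (a :* e :+ b :* g) :* i :+ (a :* f :+ b :* h) :* k := a :* (e :* i :+ f :* k) :+ b :* (g :* i :+ h :* k)) refl a b c d e f g h i j k l)
  (solve 12 (λ a b c d e f g h i j k l → (a :* e :+ b :* g) :* j :+ (a :* f :+ b :* h) :* l := a :* (e :* j :+ f :* l) :+ b :* (g :* j :+ h :* l)) refl a b c d e f g h i j k l)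
  (solve 12 (λ a b c d e f g h i j k l → (c :* e :+ d :* g) :* i :+ (c :* f :+ d :* h) :* k := c :* (e :* i :+ f :* k) :+ d :* (g :* i :+ h :* k)) refl a b c d e f g h i j k l)
  (solve 12 (λ a b c d e f g h i j k l → (c :* e :+ d :* g) :* j :+ (c :* f :+ d :* h) :* l := c :* (e :* j :+ f :* l) :+ d :* (g :* j :+ h :* l)) refl a b c d e f g h i j k l)
  where open Ring n

module PeriodicCF {m : ℕ} (a₀ a₁ a₂ : R m) where
  open Ring m

  c : ℕ → R m
  c = cfSeq a₀ a₁ a₂

  -- A = M(a₀) M(a₁) M(a₂) M(a₀)⁻¹ advances the convergent matrix by one period.
  α β γ δ : R m
  α = a₀ ⊗ a₁ ⊕ 𝟙
  β = α ⊗ (a₂ ⊝ a₀) ⊕ a₀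
  γ = a₁
  δ = a₁ ⊗ a₂ ⊕ 𝟙 ⊝ a₀ ⊗ a₁

  A : Mat (R m)
  A = mat α β γ δ

  private
    convMat-2 : convMat c 2 ≡ A · elemMat a₀
    convMat-2 = subst₂ (λ o z → (mat a₀ o o z · mat a₁ o o z) · mat a₂ o o z ≡
                               mat (a₀ ⊗ a₁ ⊕ o) ((a₀ ⊗ a₁ ⊕ o) ⊗ (a₂ ⊝ a₀) ⊕ a₀) a₁ (a₁ ⊗ a₂ ⊕ o ⊝ a₀ ⊗ a₁) · mat a₀ o o z)
      fromℤ-1 fromℤ-0 (mat-cong
        (solve 3 (λ a₀ a₁ a₂ → (a₀ :* a₁ :+ 𝟏 :* 𝟏) :* a₂ :+ (a₀ :* 𝟏 :+ 𝟏 :* 𝟎) :* 𝟏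
                             := (a₀ :* a₁ :+ 𝟏) :* a₀ :+ ((a₀ :* a₁ :+ 𝟏) :* (a₂ :- a₀) :+ a₀) :* 𝟏) refl a₀ a₁ a₂)
        (solve 3 (λ a₀ a₁ a₂ → (a₀ :* a₁ :+ 𝟏 :* 𝟏) :* 𝟏 :+ (a₀ :* 𝟏 :+ 𝟏 :* 𝟎) :* 𝟎
                             := (a₀ :* a₁ :+ 𝟏) :* 𝟏 :+ ((a₀ :* a₁ :+ 𝟏) :* (a₂ :- a₀) :+ a₀) :* 𝟎) refl a₀ a₁ a₂)
        (solve 3 (λ a₀ a₁ a₂ → (𝟏 :* a₁ :+ 𝟎 :* 𝟏) :* a₂ :+ (𝟏 :* 𝟏 :+ 𝟎 :* 𝟎) :* 𝟏
                             := a₁ :* a₀ :+ (a₁ :* a₂ :+ 𝟏 :- a₀ :* a₁) :* 𝟏) refl a₀ a₁ a₂)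
        (solve 3 (λ a₀ a₁ a₂ → (𝟏 :* a₁ :+ 𝟎 :* 𝟏) :* 𝟏 :+ (𝟏 :* 𝟏 :+ 𝟎 :* 𝟎) :* 𝟎
                             := a₁ :* 𝟏 :+ (a₁ :* a₂ :+ 𝟏 :- a₀ :* a₁) :* 𝟎) refl a₀ a₁ a₂))
      where
      𝟏 : ∀ {k} → Polynomial k
      𝟏 = con 1ℤ
      𝟎 : ∀ {k} → Polynomial k
      𝟎 = con 0ℤ

  convMat-period : ∀ k → convMat c (suc (suc k)) ≡ A · convMat c k
  convMat-period zero    = convMat-2
  convMat-period (suc k) = trans (cong (_· elemMat (c (suc k))) (convMat-period k)) (·-assoc A (convMat c k) (elemMat (c (suc k))))

  pconv-period : ∀ k → pconv c (suc (suc k)) ≡ α ⊗ pconv c k ⊕ β ⊗ qconv c k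
  pconv-period k = cong m₁₁ (convMat-period k)

  qconv-period : ∀ k → qconv c (suc (suc k)) ≡ γ ⊗ pconv c k ⊕ δ ⊗ qconv c k
  qconv-period k = cong m₂₁ (convMat-period k)

  pconv-1 : pconv c 1 ≡ α
  pconv-1 = cong (a₀ ⊗ a₁ ⊕_) (*-identityˡ 𝟙)

  qconv-1 : qconv c 1 ≡ γ
  qconv-1 = trans (cong₂ _⊕_ (*-identityˡ a₁) (zeroˡ 𝟙)) (+-identityʳ a₁)

  private
    module S = Ring (suc m)

  -- L (X (suc m)) k = q_k (p_k / q_k - X), the error that CFEquals controls.
  L : R (suc m) → ℕ → R (suc m)
  L r k = ι (pconv c k) ⊝ r ⊗ ι (qconv c k)

  μ : R (suc m) → R (suc m)
  μ r = ι α ⊝ r ⊗ ι γ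

  E : R (suc m) → R (suc m)
  E r = ι (β ⊝ D m ⊗ γ) ⊕ r ⊗ ι (α ⊝ δ)

  L-period : ∀ r → r ⊗ r ≡ ι (D m) → ∀ k → L r (suc (suc k)) ≡ μ r ⊗ L r k ⊕ E r ⊗ ι (qconv c k)
  L-period r r²≡D k = begin
    L r (suc (suc k))
      ≡⟨ cong₂ (λ u v → u ⊝ r ⊗ v) (ι-linear (pconv-period k)) (ι-linear (qconv-period k)) ⟩
    (ι α ⊗ P ⊕ ι β ⊗ Q) ⊝ r ⊗ (ι γ ⊗ P ⊕ ι δ ⊗ Q)
      ≡⟨ S.solve 8 (λ r α β γ δ P Q d → (α S.:* P S.:+ β S.:* Q) S.:- r S.:* (γ S.:* P S.:+ δ S.:* Q) S.:=
                     ((α S.:- r S.:* γ) S.:* (P S.:- r S.:* Q) S.:+ ((β S.:- d S.:* γ) S.:+ r S.:* (α S.:- δ)) S.:* Q)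
                     S.:+ (d S.:- r S.:* r) S.:* (γ S.:* Q))
           refl r (ι α) (ι β) (ι γ) (ι δ) P Q (ι (D m)) ⟩
    (μ r ⊗ L r k ⊕ E′ ⊗ Q) ⊕ (ι (D m) ⊝ r ⊗ r) ⊗ (ι γ ⊗ Q)
      ≡⟨ cong (λ z → (μ r ⊗ L r k ⊕ E′ ⊗ Q) ⊕ (ι (D m) ⊝ z) ⊗ (ι γ ⊗ Q)) r²≡D ⟩
    (μ r ⊗ L r k ⊕ E′ ⊗ Q) ⊕ (ι (D m) ⊝ ι (D m)) ⊗ (ι γ ⊗ Q)
      ≡⟨ trans (cong (μ r ⊗ L r k ⊕ E′ ⊗ Q ⊕_) (trans (cong (_⊗ (ι γ ⊗ Q)) (S.-‿inverseʳ _)) (S.zeroˡ _))) (S.+-identityʳ _) ⟩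
    μ r ⊗ L r k ⊕ E′ ⊗ Q
      ≡⟨ cong (λ z → μ r ⊗ L r k ⊕ z ⊗ Q) E′≡E ⟩
    μ r ⊗ L r k ⊕ E r ⊗ Q ∎
    where
    open ≡-Reasoning
    P : R (suc m)
    P = ι (pconv c k)
    Q : R (suc m)
    Q = ι (qconv c k)
    E′ : R (suc m)
    E′ = (ι β ⊝ ι (D m) ⊗ ι γ) ⊕ r ⊗ (ι α ⊝ ι δ)
    E′≡E : E′ ≡ E r
    E′≡E = sym (cong₂ (λ u v → u ⊕ r ⊗ v) (trans (ι-⊝ β (D m ⊗ γ)) (cong (ι β ⊝_) (ι-⊗ (D m) γ))) (ι-⊝ α δ))
    ι-linear : ∀ {x a b u v : R m} → x ≡ a ⊗ u ⊕ b ⊗ v → ι x ≡ ι a ⊗ ι u ⊕ ι b ⊗ ι v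
    ι-linear {a = a} {b} {u} {v} refl = trans (ι-⊕ (a ⊗ u) (b ⊗ v)) (cong₂ _⊕_ (ι-⊗ a u) (ι-⊗ b v))

  L-power : ∀ r → r ⊗ r ≡ ι (D m) → E r ≡ 𝟘 → ∀ j i → L r (j ℕ.* 2 ℕ.+ i) ≡ μ r ^ j ⊗ L r i
  L-power r r²≡D E≡𝟘 zero    i = sym (S.*-identityˡ _)
  L-power r r²≡D E≡𝟘 (suc j) i = begin
    L r (suc (suc k))                        ≡⟨ L-period r r²≡D k ⟩
    μ r ⊗ L r k ⊕ E r ⊗ ι (qconv c k)        ≡⟨ cong (λ z → μ r ⊗ L r k ⊕ z ⊗ ι (qconv c k)) E≡𝟘 ⟩
    μ r ⊗ L r k ⊕ 𝟘 ⊗ ι (qconv c k)          ≡⟨ trans (cong (μ r ⊗ L r k ⊕_) (S.zeroˡ _)) (S.+-identityʳ _) ⟩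
    μ r ⊗ L r k                              ≡⟨ cong (μ r ⊗_) (L-power r r²≡D E≡𝟘 j i) ⟩
    μ r ⊗ (μ r ^ j ⊗ L r i)                  ≡⟨ S.*-assoc _ _ _ ⟨
    μ r ^ suc j ⊗ L r i                      ∎
    where
    open ≡-Reasoning
    k : ℕ
    k = j ℕ.* 2 ℕ.+ i

  abs-L-power : ∀ r → r ⊗ r ≡ ι (D m) → E r ≡ 𝟘 → ∀ j i → abs (L r (j ℕ.* 2 ℕ.+ i)) ≡ abs (μ r) ^ j ⊗ abs (L r i)
  abs-L-power r r²≡D E≡𝟘 j i =
    trans (cong abs (L-power r r²≡D E≡𝟘 j i)) (trans (abs-⊗ _ _) (cong (_⊗ abs (L r i)) (abs-^ (μ r) j)))
    where open Absolute (suc m)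

  E-vanishes : β ⊝ D m ⊗ γ ≡ 𝟘 → α ⊝ δ ≡ 𝟘 → ∀ r → E r ≡ 𝟘
  E-vanishes β≡Dγ α≡δ r = begin
    ι (β ⊝ D m ⊗ γ) ⊕ r ⊗ ι (α ⊝ δ) ≡⟨ cong₂ (λ u v → ι u ⊕ r ⊗ ι v) β≡Dγ α≡δ ⟩
    ι 𝟘 ⊕ r ⊗ ι 𝟘                   ≡⟨ cong (ι 𝟘 ⊕_) (S.zeroʳ r) ⟩
    ι 𝟘 ⊕ 𝟘                         ≡⟨ S.+-identityʳ _ ⟩
    𝟘                               ∎
    where open ≡-Reasoning

  E-X≡ : E (X (suc m)) ≡ (β ⊝ D m ⊗ γ , α ⊝ δ)
  E-X≡ = ι⊕X⊗ι (β ⊝ D m ⊗ γ) (α ⊝ δ)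

  L-1 : ∀ r → L r 1 ≡ μ r
  L-1 r = cong₂ (λ u v → ι u ⊝ r ⊗ ι v) pconv-1 qconv-1

  L-⊖-difference : ∀ r k → L (⊖ r) k ⊝ L r k ≡ (r ⊕ r) ⊗ ι (qconv c k)
  L-⊖-difference r k = S.solve 3 (λ p x q → (p S.:- (S.:- x) S.:* q) S.:- (p S.:- x S.:* q) S.:= (x S.:+ x) S.:* q)
                          refl (ι (pconv c k)) r (ι (qconv c k))

  μ-⊗-μ-⊖ : ∀ r → r ⊗ r ≡ ι (D m) → μ r ⊗ μ (⊖ r) ≡ ι (Nrel (α , γ))
  μ-⊗-μ-⊖ r r²≡D = begin
    μ r ⊗ μ (⊖ r)                                ≡⟨ S.solve 3 (λ a x g → (a S.:- x S.:* g) S.:* (a S.:- (S.:- x) S.:* g) S.:=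
                                                                          a S.:* a S.:- (x S.:* x) S.:* (g S.:* g)) refl (ι α) r (ι γ) ⟩
    ι α ⊗ ι α ⊝ (r ⊗ r) ⊗ (ι γ ⊗ ι γ)           ≡⟨ cong (λ z → ι α ⊗ ι α ⊝ z ⊗ (ι γ ⊗ ι γ)) r²≡D ⟩
    ι α ⊗ ι α ⊝ ι (D m) ⊗ (ι γ ⊗ ι γ)           ≡⟨ cong₂ (λ u v → u ⊝ ι (D m) ⊗ v) (ι-⊗ α α) (ι-⊗ γ γ) ⟨
    ι (α ⊗ α) ⊝ ι (D m) ⊗ ι (γ ⊗ γ)             ≡⟨ cong (ι (α ⊗ α) ⊝_) (ι-⊗ (D m) (γ ⊗ γ)) ⟨
    ι (α ⊗ α) ⊝ ι (D m ⊗ (γ ⊗ γ))               ≡⟨ ι-⊝ (α ⊗ α) (D m ⊗ (γ ⊗ γ)) ⟨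
    ι (Nrel (α , γ))                             ∎
    where open ≡-Reasoning

  μ-⊖-square-difference : ∀ r → μ (⊖ r) ⊗ μ (⊖ r) ⊝ μ r ⊗ μ r ≡ ((r ⊕ r) ⊕ (r ⊕ r)) ⊗ ι (α ⊗ γ)
  μ-⊖-square-difference r = trans
    (S.solve 3 (λ a x g → (a S.:- (S.:- x) S.:* g) S.:* (a S.:- (S.:- x) S.:* g) S.:- (a S.:- x S.:* g) S.:* (a S.:- x S.:* g)
                          S.:= ((x S.:+ x) S.:+ (x S.:+ x)) S.:* (a S.:* g)) refl (ι α) r (ι γ))
    (cong (((r ⊕ r) ⊕ (r ⊕ r)) ⊗_) (sym (ι-⊗ α γ)))

  qconv-period-L : ∀ r k → ι (qconv c (suc (suc k))) ≡ ι γ ⊗ L r k ⊕ (ι γ ⊗ r ⊕ ι δ) ⊗ ι (qconv c k)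
  qconv-period-L r k = begin
    ι (qconv c (suc (suc k)))                        ≡⟨ cong ι (qconv-period k) ⟩
    ι (γ ⊗ pconv c k ⊕ δ ⊗ qconv c k)                ≡⟨ trans (ι-⊕ _ _) (cong₂ _⊕_ (ι-⊗ γ _) (ι-⊗ δ _)) ⟩
    ι γ ⊗ ι (pconv c k) ⊕ ι δ ⊗ ι (qconv c k)        ≡⟨ S.solve 5 (λ g d p q x → g S.:* p S.:+ d S.:* q S.:=
                                                          g S.:* (p S.:- x S.:* q) S.:+ (g S.:* x S.:+ d) S.:* q)
                                                          refl (ι γ) (ι δ) (ι (pconv c k)) (ι (qconv c k)) r ⟩
    ι γ ⊗ L r k ⊕ (ι γ ⊗ r ⊕ ι δ) ⊗ ι (qconv c k)    ∎
    where open ≡-Reasoning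

  E⊗qconv : ∀ r → r ⊗ r ≡ ι (D m) → ∀ k → E r ⊗ ι (qconv c k) ≡ L r (suc (suc k)) ⊝ μ r ⊗ L r k
  E⊗qconv r r²≡D k = trans (S.solve 2 (λ a b → b S.:= (a S.:+ b) S.:- a) refl (μ r ⊗ L r k) (E r ⊗ ι (qconv c k)))
                           (cong (_⊝ μ r ⊗ L r k) (sym (L-period r r²≡D k)))

-- Periodic expansions come from units

module ConvergentExpansion {m : ℕ} (a₀ a₁ a₂ : R m) (conv : CFEquals (X (suc m)) (cfSeq a₀ a₁ a₂)) where
  open PeriodicCF a₀ a₁ a₂
  open Ring (suc m)
  open Order (signLaws (suc m))
  open Embeddings (suc m)
  open Absolute (suc m)
  open Powers (suc m)

  private
    ξ : R (suc m)
    ξ = X (suc m)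
    Q : ℕ → R (suc m)
    Q k = ι (qconv c k)

  E-bound : R (suc m)
  E-bound = (abs (ι γ) ⊕ abs (ι γ ⊗ ξ ⊕ ι δ)) ⊕ abs (μ ξ)

  -- E ξ ⊗ q_K = L ξ (K+2) - μ ξ ⊗ L ξ K, where both L's are small against q_K and q_{K+2} = O(q_K).
  E-bounded : ∀ M → fromℕ (suc M) ⊗ abs (E ξ) <ᴿ E-bound
  E-bounded M with conv M
  ... | K , close = *-cancelˡ-< Pos-|QK| (subst₂ _<ᴿ_ (*-comm _ _) (*-comm _ _) chain)
    where
    open ≤-Reasoning
    F : R (suc m)
    F = fromℕ (suc M)
    NonNeg-F : NonNeg F
    NonNeg-F = fromℕ-NonNeg (suc M)
    close-K : F ⊗ abs (L ξ K) <ᴿ abs (Q K)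
    close-K = close K ℕ.≤-refl
    close-K+2 : F ⊗ abs (L ξ (suc (suc K))) <ᴿ abs (Q (suc (suc K)))
    close-K+2 = close (suc (suc K)) (ℕ.≤-trans (ℕ.n≤1+n K) (ℕ.n≤1+n (suc K)))
    Pos-|QK| : Pos (abs (Q K))
    Pos-|QK| = 0<⇒Pos (≤-<-trans (NonNeg⇒0≤ (NonNeg-⊗ NonNeg-F (NonNeg-abs _))) close-K)
    |L|≤|Q| : abs (L ξ K) ≤ᴿ abs (Q K)
    |L|≤|Q| = <⇒≤ (≤-<-trans (subst (_≤ᴿ F ⊗ abs (L ξ K)) (*-identityˡ _)
                               (*-mono-≤ NonNeg-𝟙 (𝟙≤fromℕ-suc M) (NonNeg-abs _) ≤-refl)) close-K)
    |Q+2|≤ : abs (Q (suc (suc K))) ≤ᴿ (abs (ι γ) ⊕ abs (ι γ ⊗ ξ ⊕ ι δ)) ⊗ abs (Q K)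
    |Q+2|≤ = begin
      abs (Q (suc (suc K)))                                         ≡⟨ cong abs (qconv-period-L ξ K) ⟩
      abs (ι γ ⊗ L ξ K ⊕ (ι γ ⊗ ξ ⊕ ι δ) ⊗ Q K)                     ≤⟨ abs-triangle _ _ ⟩
      abs (ι γ ⊗ L ξ K) ⊕ abs ((ι γ ⊗ ξ ⊕ ι δ) ⊗ Q K)               ≡⟨ cong₂ _⊕_ (abs-⊗ _ _) (abs-⊗ _ _) ⟩
      abs (ι γ) ⊗ abs (L ξ K) ⊕ abs (ι γ ⊗ ξ ⊕ ι δ) ⊗ abs (Q K)     ≤⟨ +-mono-≤ (*-monoˡ-≤ (NonNeg-abs _) |L|≤|Q|) ≤-refl ⟩
      abs (ι γ) ⊗ abs (Q K) ⊕ abs (ι γ ⊗ ξ ⊕ ι δ) ⊗ abs (Q K)       ≡⟨ distribʳ _ _ _ ⟨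
      (abs (ι γ) ⊕ abs (ι γ ⊗ ξ ⊕ ι δ)) ⊗ abs (Q K)                 ∎
    chain : (F ⊗ abs (E ξ)) ⊗ abs (Q K) <ᴿ E-bound ⊗ abs (Q K)
    chain = begin-strict
      (F ⊗ abs (E ξ)) ⊗ abs (Q K)                                   ≡⟨ trans (*-assoc _ _ _) (cong (F ⊗_) (sym (abs-⊗ _ _))) ⟩
      F ⊗ abs (E ξ ⊗ Q K)                                           ≡⟨ cong (λ z → F ⊗ abs z) (E⊗qconv ξ (X-squared m) K) ⟩
      F ⊗ abs (L ξ (suc (suc K)) ⊝ μ ξ ⊗ L ξ K)                     ≤⟨ *-monoˡ-≤ NonNeg-F (abs-triangle _ _) ⟩
      F ⊗ (abs (L ξ (suc (suc K))) ⊕ abs (⊖ (μ ξ ⊗ L ξ K)))        ≡⟨ cong (λ z → F ⊗ (abs (L ξ (suc (suc K))) ⊕ z)) (trans (abs-⊖ _) (abs-⊗ _ _)) ⟩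
      F ⊗ (abs (L ξ (suc (suc K))) ⊕ abs (μ ξ) ⊗ abs (L ξ K))      ≡⟨ solve 4 (λ f a u l → f :* (a :+ u :* l) := f :* a :+ u :* (f :* l)) refl F _ _ _ ⟩
      F ⊗ abs (L ξ (suc (suc K))) ⊕ abs (μ ξ) ⊗ (F ⊗ abs (L ξ K))  <⟨ +-mono-<-≤ close-K+2 (*-monoˡ-≤ (NonNeg-abs _) (<⇒≤ close-K)) ⟩
      abs (Q (suc (suc K))) ⊕ abs (μ ξ) ⊗ abs (Q K)                 ≤⟨ +-mono-≤ |Q+2|≤ ≤-refl ⟩
      (abs (ι γ) ⊕ abs (ι γ ⊗ ξ ⊕ ι δ)) ⊗ abs (Q K) ⊕ abs (μ ξ) ⊗ abs (Q K) ≡⟨ distribʳ _ _ _ ⟨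
      E-bound ⊗ abs (Q K)                                           ∎

  E-ξ≡𝟘 : E ξ ≡ 𝟘
  E-ξ≡𝟘 with ≡𝟘⊎Pos-abs (E ξ)
  ... | inj₁ E≡𝟘   = E≡𝟘
  ... | inj₂ Pos-E = let M , bound<ME = archimedean (suc m) (abs (E ξ)) E-bound Pos-E
                     in ⊥-elim (<-asym bound<ME (E-bounded M))

  β≡Dγ : β ⊝ D m ⊗ γ ≡ 𝟘
  β≡Dγ = cong proj₁ (trans (sym E-X≡) E-ξ≡𝟘)

  α≡δ : α ⊝ δ ≡ 𝟘
  α≡δ = cong proj₂ (trans (sym E-X≡) E-ξ≡𝟘)

  -- At odd k the powers of μ give |L ξ k| ≥ 1 and |L (⊖ ξ) k| ≤ 1, so
  -- 2ξ |q_k| = |L (⊖ ξ) k ⊝ L ξ k| ≤ 1 + |L ξ k| ≤ 2ξ |L ξ k|, against |L ξ k| < |q_k|.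
  ¬contracting-μ-⊖ξ : abs (μ (⊖ ξ)) <ᴿ 𝟙 → ¬ (𝟙 <ᴿ abs (μ ξ))
  ¬contracting-μ-⊖ξ small large = <-irrefl (begin-strict
    2ξ ⊗ abs Lₖ                  <⟨ *-monoˡ-< Pos-2ξ |L|<|Q| ⟩
    2ξ ⊗ abs (Q k)               ≡⟨ trans (cong (_⊗ abs (Q k)) (sym (abs-NonNeg 2ξ (inj₁ Pos-2ξ)))) (sym (abs-⊗ 2ξ (Q k))) ⟩
    abs (2ξ ⊗ Q k)               ≡⟨ cong abs (sym (L-⊖-difference ξ k)) ⟩
    abs (L′ₖ ⊝ Lₖ)               ≤⟨ abs-triangle L′ₖ (⊖ Lₖ) ⟩
    abs L′ₖ ⊕ abs (⊖ Lₖ)         ≡⟨ cong (abs L′ₖ ⊕_) (abs-⊖ Lₖ) ⟩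
    abs L′ₖ ⊕ abs Lₖ             ≤⟨ +-mono-≤ |L′|≤𝟙 ≤-refl ⟩
    𝟙 ⊕ abs Lₖ                   ≤⟨ +-mono-≤ 𝟙≤[2ξ-𝟙]|L| ≤-refl ⟩
    (2ξ ⊝ 𝟙) ⊗ abs Lₖ ⊕ abs Lₖ   ≡⟨ cong ((2ξ ⊝ 𝟙) ⊗ abs Lₖ ⊕_) (*-identityˡ _) ⟨
    (2ξ ⊝ 𝟙) ⊗ abs Lₖ ⊕ 𝟙 ⊗ abs Lₖ ≡⟨ solve 3 (λ x o l → (x :- o) :* l :+ o :* l := x :* l) refl 2ξ 𝟙 (abs Lₖ) ⟩
    2ξ ⊗ abs Lₖ                  ∎)
    where
    open ≤-Reasoning
    2ξ : R (suc m)
    2ξ = ξ ⊕ ξ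
    Pos-2ξ : Pos 2ξ
    Pos-2ξ = Pos-⊕ ξ ξ (X-Pos m) (X-Pos m)
    K : ℕ
    K = proj₁ (conv 0)
    k : ℕ
    k = K ℕ.* 2 ℕ.+ 1
    Lₖ : R (suc m)
    Lₖ = L ξ k
    L′ₖ : R (suc m)
    L′ₖ = L (⊖ ξ) k
    |L|<|Q| : abs Lₖ <ᴿ abs (Q k)
    |L|<|Q| = subst (_<ᴿ abs (Q k)) (trans (cong (_⊗ abs Lₖ) fromℤ-1) (*-identityˡ _))
                (proj₂ (conv 0) k (ℕ.≤-trans (ℕ.m≤m*n K 2) (ℕ.m≤m+n (K ℕ.* 2) 1)))
    E≡𝟘 : ∀ r → E r ≡ 𝟘
    E≡𝟘 = E-vanishes β≡Dγ α≡δ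
    |L-odd| : ∀ r → r ⊗ r ≡ ι (D m) → abs (L r k) ≡ abs (μ r) ^ K ⊗ abs (μ r)
    |L-odd| r r²≡D = trans (abs-L-power r r²≡D (E≡𝟘 r) K 1) (cong (λ t → abs (μ r) ^ K ⊗ abs t) (L-1 r))
    𝟙≤|L| : 𝟙 ≤ᴿ abs Lₖ
    𝟙≤|L| = subst₂ _≤ᴿ_ (*-identityˡ 𝟙) (sym (|L-odd| ξ (X-squared m)))
              (*-mono-≤ NonNeg-𝟙 (𝟙≤^ (<⇒≤ large) K) NonNeg-𝟙 (<⇒≤ large))
    |L′|≤𝟙 : abs L′ₖ ≤ᴿ 𝟙
    |L′|≤𝟙 = subst₂ _≤ᴿ_
               (sym (|L-odd| (⊖ ξ) (⊖X-squared m)))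
               (*-identityˡ 𝟙)
               (*-mono-≤ (NonNeg-^ (NonNeg-abs _) K) (^≤𝟙 (NonNeg-abs _) (<⇒≤ small) K) (NonNeg-abs _) (<⇒≤ small))
    𝟙≤[2ξ-𝟙]|L| : 𝟙 ≤ᴿ (2ξ ⊝ 𝟙) ⊗ abs Lₖ
    𝟙≤[2ξ-𝟙]|L| = subst (_≤ᴿ (2ξ ⊝ 𝟙) ⊗ abs Lₖ) (*-identityˡ 𝟙) (*-mono-≤ NonNeg-𝟙 𝟙≤2ξ-𝟙 NonNeg-𝟙 𝟙≤|L|)
      where
      𝟙≤2ξ-𝟙 : 𝟙 ≤ᴿ 2ξ ⊝ 𝟙
      𝟙≤2ξ-𝟙 = <⇒≤ (subst Pos (solve 2 (λ x o → (x :- o) :+ (x :- o) := ((x :+ x) :- o) :- o) refl ξ 𝟙) (Pos-⊕ _ _ (𝟙<X m) (𝟙<X m)))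

alt-const : ∀ {A : Set} (a : A) j → alt a a j ≡ a
alt-const a zero    = refl
alt-const a (suc j) = alt-const a j

module PeriodicExpansion {m : ℕ} (a₀ a₁ a₂ : R m) (type : HasType (cfSeq a₀ a₁ a₂) 1 2) (conv : CFEquals (X (suc m)) (cfSeq a₀ a₁ a₂)) where
  open PeriodicCF a₀ a₁ a₂
  open ConvergentExpansion a₀ a₁ a₂ conv using (β≡Dγ; α≡δ; ¬contracting-μ-⊖ξ)
  open Ring m
  open Order (signLaws m)

  -- Otherwise β - D γ = a₂ forces a₂ = 𝟘, and [a₀, 𝟘, 𝟘, …] has period 1.
  a₁≢𝟘 : a₁ ≢ 𝟘
  a₁≢𝟘 a₁≡𝟘 = ℕ.<-irrefl refl (proj₂ (proj₂ (proj₂ type′) 1 1 ℕ.≤-refl period-1))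
    where
    β-at-𝟘 : (a₀ ⊗ 𝟘 ⊕ 𝟙) ⊗ (a₂ ⊝ a₀) ⊕ a₀ ⊝ D m ⊗ 𝟘 ≡ a₂
    β-at-𝟘 = subst₂ (λ o z → (a₀ ⊗ z ⊕ o) ⊗ (a₂ ⊝ a₀) ⊕ a₀ ⊝ D m ⊗ z ≡ a₂) fromℤ-1 fromℤ-0
      (solve 3 (λ a₀ a₂ d → (a₀ :* con 0ℤ :+ con 1ℤ) :* (a₂ :- a₀) :+ a₀ :- d :* con 0ℤ := a₂) refl a₀ a₂ (D m))
    a₂≡𝟘 : a₂ ≡ 𝟘
    a₂≡𝟘 = trans (sym β-at-𝟘) (subst (λ t → (a₀ ⊗ t ⊕ 𝟙) ⊗ (a₂ ⊝ a₀) ⊕ a₀ ⊝ D m ⊗ t ≡ 𝟘) a₁≡𝟘 β≡Dγ)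
    type′ : HasType (cfSeq a₀ 𝟘 𝟘) 1 2
    type′ = subst₂ (λ x y → HasType (cfSeq a₀ x y) 1 2) a₁≡𝟘 a₂≡𝟘 type
    period-1 : PeriodicFrom (cfSeq a₀ 𝟘 𝟘) 1 1
    period-1 (suc j) _ = trans (alt-const 𝟘 (j ℕ.+ 1)) (sym (alt-const 𝟘 j))

  a₂≡a₀⊕a₀ : a₂ ≡ a₀ ⊕ a₀
  a₂≡a₀⊕a₀ = sym (x∙y⁻¹≈ε⇒x≈y _ _ (⊗≡𝟘⇒≡𝟘 a₁≢𝟘 (trans (sym α⊝δ≡) α≡δ)))
    where
    α⊝δ≡ : α ⊝ δ ≡ a₁ ⊗ ((a₀ ⊕ a₀) ⊝ a₂)
    α⊝δ≡ = solve 4 (λ a₀ a₁ a₂ o → (a₀ :* a₁ :+ o) :- ((a₁ :* a₂ :+ o) :- a₀ :* a₁) := a₁ :* ((a₀ :+ a₀) :- a₂)) refl a₀ a₁ a₂ 𝟙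

  Nrel-αγ : Nrel (α , γ) ≡ 𝟙
  Nrel-αγ = x∙y⁻¹≈ε⇒x≈y _ _ (begin
    Nrel (α , a₁) ⊝ 𝟙                                   ≡⟨ Nrel⊝𝟙≡ ⟩
    a₁ ⊗ (β ⊝ D m ⊗ a₁) ⊝ (a₁ ⊗ α) ⊗ (a₂ ⊝ (a₀ ⊕ a₀))  ≡⟨ cong₂ (λ u v → a₁ ⊗ u ⊝ (a₁ ⊗ α) ⊗ v) β≡Dγ (x≈y⇒x∙y⁻¹≈ε a₂≡a₀⊕a₀) ⟩
    a₁ ⊗ 𝟘 ⊝ (a₁ ⊗ α) ⊗ 𝟘                              ≡⟨ trans (cong₂ _⊝_ (zeroʳ a₁) (zeroʳ _)) (-‿inverseʳ 𝟘) ⟩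
    𝟘                                                   ∎)
    where
    open ≡-Reasoning
    Nrel⊝𝟙≡ : Nrel (α , a₁) ⊝ 𝟙 ≡ a₁ ⊗ (β ⊝ D m ⊗ a₁) ⊝ (a₁ ⊗ α) ⊗ (a₂ ⊝ (a₀ ⊕ a₀))
    Nrel⊝𝟙≡ = subst (λ o → ((a₀ ⊗ a₁ ⊕ o) ⊗ (a₀ ⊗ a₁ ⊕ o) ⊝ D m ⊗ (a₁ ⊗ a₁)) ⊝ o ≡
                           a₁ ⊗ ((a₀ ⊗ a₁ ⊕ o) ⊗ (a₂ ⊝ a₀) ⊕ a₀ ⊝ D m ⊗ a₁) ⊝ (a₁ ⊗ (a₀ ⊗ a₁ ⊕ o)) ⊗ (a₂ ⊝ (a₀ ⊕ a₀))) fromℤ-1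
      (solve 4 (λ a₀ a₁ a₂ d → ((a₀ :* a₁ :+ con 1ℤ) :* (a₀ :* a₁ :+ con 1ℤ) :- d :* (a₁ :* a₁)) :- con 1ℤ :=
                               a₁ :* ((a₀ :* a₁ :+ con 1ℤ) :* (a₂ :- a₀) :+ a₀ :- d :* a₁) :- (a₁ :* (a₀ :* a₁ :+ con 1ℤ)) :* (a₂ :- (a₀ :+ a₀)))
         refl a₀ a₁ a₂ (D m))

  α≢𝟘 : α ≢ 𝟘
  α≢𝟘 α≡𝟘 = Pos⇒≢neg (Pos-𝟙 m) (begin
    sgn (𝟙 {m})                     ≡⟨ cong sgn Nrel-αγ ⟨
    sgn (Nrel (α , a₁))             ≡⟨ cong (λ t → sgn (Nrel (t , a₁))) α≡𝟘 ⟩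
    sgn (Nrel (𝟘 , a₁))             ≡⟨ cong sgn (Nrel-𝟘b a₁) ⟩
    sgn (⊖ (D m ⊗ (a₁ ⊗ a₁)))       ≡⟨ Pos⇒neg-⊖ (Pos-⊗ (D-Pos (signLaws m)) (square-Pos a₁ λ e → a₁≢𝟘 (sgn≡zer⇒≡𝟘 a₁ e))) ⟩
    neg                             ∎)
    where open ≡-Reasoning

  -- If α γ < 0 then μ (⊖ ξ)² < μ ξ², and as μ ξ ⊗ μ (⊖ ξ) = 𝟙 that puts |μ (⊖ ξ)| < 1 < |μ ξ|.
  Pos-α⊗γ : Pos (α ⊗ γ)
  Pos-α⊗γ = Pos-stable (α ⊗ a₁) λ ¬pos →
    let |μ⁻|<𝟙 , 𝟙<|μ| = Absolute.unit-split (suc m) μ⁻⊗μ≡𝟙 (μ⁻²<μ² ¬pos)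
    in ¬contracting-μ-⊖ξ |μ⁻|<𝟙 𝟙<|μ|
    where
    ξ : R (suc m)
    ξ = X (suc m)
    module S = Ring (suc m)
    module SO = Order (signLaws (suc m))
    μ⁻⊗μ≡𝟙 : μ (⊖ ξ) ⊗ μ ξ ≡ 𝟙
    μ⁻⊗μ≡𝟙 = trans (S.*-comm _ _) (trans (μ-⊗-μ-⊖ ξ (X-squared m)) (cong ι Nrel-αγ))
    μ⁻²<μ² : ¬ Pos (α ⊗ a₁) → μ (⊖ ξ) ⊗ μ (⊖ ξ) <ᴿ μ ξ ⊗ μ ξ
    μ⁻²<μ² ¬pos = SO.sgn-⊝≡neg⇒< (begin
      sgn (μ (⊖ ξ) ⊗ μ (⊖ ξ) ⊝ μ ξ ⊗ μ ξ)       ≡⟨ cong sgn (μ-⊖-square-difference ξ) ⟩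
      sgn (4ξ ⊗ ι (α ⊗ γ))                     ≡⟨ SO.sgn-⊗ 4ξ (ι (α ⊗ γ)) ⟩
      sgn 4ξ *ˢ sgn (ι (α ⊗ γ))                ≡⟨ cong₂ _*ˢ_ Pos-4ξ (trans (sgn-ι (α ⊗ γ)) αγ-neg) ⟩
      neg                                      ∎)
      where
      open ≡-Reasoning
      4ξ : R (suc m)
      4ξ = (ξ ⊕ ξ) ⊕ (ξ ⊕ ξ)
      Pos-4ξ : Pos 4ξ
      Pos-4ξ = SO.Pos-⊕ _ _ (SO.Pos-⊕ ξ ξ (X-Pos m) (X-Pos m)) (SO.Pos-⊕ ξ ξ (X-Pos m) (X-Pos m))
      αγ-neg : sgn (α ⊗ γ) ≡ neg
      αγ-neg = ≢𝟘∧¬Pos⇒neg (λ αγ≡𝟘 → a₁≢𝟘 (⊗≡𝟘⇒≡𝟘 α≢𝟘 αγ≡𝟘)) ¬pos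

  periodic-expansion⇒unit :
    Σ (R (suc m)) λ ε → InRE⁺ ε × (q ε ⊗ a₀ ≡ p ε ⊝ 𝟙) × (a₁ ≡ q ε) × (q ε ⊗ a₂ ≡ two ⊗ (p ε ⊝ 𝟙)) × Pos (p ε ⊗ q ε)
  periodic-expansion⇒unit = (α , a₁) , Nrel-αγ , a₁⊗a₀≡ , refl , a₁⊗a₂≡ , Pos-α⊗γ
    where
    a₁⊗a₀≡ : a₁ ⊗ a₀ ≡ α ⊝ 𝟙
    a₁⊗a₀≡ = solve 3 (λ a₀ a₁ o → a₁ :* a₀ := (a₀ :* a₁ :+ o) :- o) refl a₀ a₁ 𝟙
    a₁⊗a₂≡ : a₁ ⊗ a₂ ≡ two ⊗ (α ⊝ 𝟙)
    a₁⊗a₂≡ = trans (cong (a₁ ⊗_) a₂≡a₀⊕a₀) (subst (λ o → a₁ ⊗ (a₀ ⊕ a₀) ≡ (o ⊕ o) ⊗ ((a₀ ⊗ a₁ ⊕ o) ⊝ o)) fromℤ-1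
               (solve 2 (λ a₀ a₁ → a₁ :* (a₀ :+ a₀) := (con 1ℤ :+ con 1ℤ) :* ((a₀ :* a₁ :+ con 1ℤ) :- con 1ℤ)) refl a₀ a₁))

-- Units give periodic expansions

eventually-by-parity : ∀ {P : ℕ → Set} →
                       (∃ λ J → ∀ j → J ℕ.≤ j → P (j ℕ.* 2 ℕ.+ 0)) → (∃ λ J → ∀ j → J ℕ.≤ j → P (j ℕ.* 2 ℕ.+ 1)) →
                       ∃ λ K → ∀ k → K ℕ.≤ k → P k
eventually-by-parity {P} (J₀ , even) (J₁ , odd) = (J₀ ℕ.+ J₁) ℕ.* 2 , λ k K≤k →
  subst P (sym (k≡ k)) (by-parity (k % 2) (m%n<n k 2) (k / 2) (subst (ℕ._≤ k / 2) (m*n/n≡m (J₀ ℕ.+ J₁) 2) (/-monoˡ-≤ 2 K≤k)))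
  where
  k≡ : ∀ k → k ≡ k / 2 ℕ.* 2 ℕ.+ k % 2
  k≡ k = trans (m≡m%n+[m/n]*n k 2) (ℕ.+-comm (k % 2) _)
  by-parity : ∀ i → i ℕ.< 2 → ∀ j → J₀ ℕ.+ J₁ ℕ.≤ j → P (j ℕ.* 2 ℕ.+ i)
  by-parity 0 _ j J≤j = even j (ℕ.≤-trans (ℕ.m≤m+n J₀ J₁) J≤j)
  by-parity 1 _ j J≤j = odd j (ℕ.≤-trans (ℕ.m≤n+m J₁ J₀) J≤j)
  by-parity (suc (suc _)) (ℕ.s≤s (ℕ.s≤s ())) _ _

module UnitExpansion {m : ℕ} (p q d : R m) (Nrel≡𝟙 : Nrel (p , q) ≡ 𝟙) (p⊝𝟙≡qd : p ⊝ 𝟙 ≡ q ⊗ d) (Pos-pq : Pos (p ⊗ q)) where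
  open PeriodicCF d q (two ⊗ d)

  private
    module B  = Ring m
    module BO = Order (signLaws m)

  q≢𝟘 : q ≢ 𝟘
  q≢𝟘 q≡𝟘 = BO.Pos⇒≢zer Pos-pq (BO.≡𝟘⇒sgn≡zer (trans (cong (p ⊗_) q≡𝟘) (B.zeroʳ p)))

  α≡p : α ≡ p
  α≡p = begin
    d ⊗ q ⊕ 𝟙        ≡⟨ cong (_⊕ 𝟙) (trans (B.*-comm d q) (sym p⊝𝟙≡qd)) ⟩
    (p ⊝ 𝟙) ⊕ 𝟙      ≡⟨ B.solve 2 (λ p o → (p B.:- o) B.:+ o B.:= p) refl p 𝟙 ⟩
    p                ∎
    where open ≡-Reasoning

  α≡δ : α ⊝ δ ≡ 𝟘
  α≡δ = subst₂ (λ o z → (d ⊗ q ⊕ o) ⊝ ((q ⊗ ((o ⊕ o) ⊗ d) ⊕ o) ⊝ d ⊗ q) ≡ z) B.fromℤ-1 B.fromℤ-0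
          (B.solve 2 (λ d q → (d B.:* q B.:+ B.con 1ℤ) B.:- ((q B.:* ((B.con 1ℤ B.:+ B.con 1ℤ) B.:* d) B.:+ B.con 1ℤ) B.:- d B.:* q)
                              B.:= B.con 0ℤ) refl d q)

  Nrel-αγ : Nrel (α , γ) ≡ 𝟙
  Nrel-αγ = trans (cong (λ t → Nrel (t , q)) α≡p) Nrel≡𝟙

  β≡Dγ : β ⊝ D m ⊗ γ ≡ 𝟘
  β≡Dγ = BO.⊗≡𝟘⇒≡𝟘 q≢𝟘 (trans q[β⊝Dq]≡ (trans (cong (_⊝ 𝟙) Nrel-αγ) (B.-‿inverseʳ 𝟙)))
    where
    q[β⊝Dq]≡ : q ⊗ (β ⊝ D m ⊗ q) ≡ Nrel (α , q) ⊝ 𝟙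
    q[β⊝Dq]≡ = subst (λ o → q ⊗ ((d ⊗ q ⊕ o) ⊗ ((o ⊕ o) ⊗ d ⊝ d) ⊕ d ⊝ D m ⊗ q) ≡ ((d ⊗ q ⊕ o) ⊗ (d ⊗ q ⊕ o) ⊝ D m ⊗ (q ⊗ q)) ⊝ o)
      B.fromℤ-1
      (B.solve 3 (λ d q k → q B.:* ((d B.:* q B.:+ B.con 1ℤ) B.:* ((B.con 1ℤ B.:+ B.con 1ℤ) B.:* d B.:- d) B.:+ d B.:- k B.:* q)
                            B.:= ((d B.:* q B.:+ B.con 1ℤ) B.:* (d B.:* q B.:+ B.con 1ℤ) B.:- k B.:* (q B.:* q)) B.:- B.con 1ℤ) refl d q (D m))

  open Ring (suc m)
  open Order (signLaws (suc m))
  open Embeddings (suc m)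
  open Absolute (suc m)
  open Powers (suc m)

  private
    ξ : R (suc m)
    ξ = X (suc m)
    2ξ : R (suc m)
    2ξ = ξ ⊕ ξ
    Pos-2ξ : Pos 2ξ
    Pos-2ξ = Pos-⊕ ξ ξ (X-Pos m) (X-Pos m)
    Q : ℕ → R (suc m)
    Q k = ι (qconv c k)
    E≡𝟘 : ∀ r → E r ≡ 𝟘
    E≡𝟘 = E-vanishes β≡Dγ α≡δ
    μ⊗μ⁻≡𝟙 : μ ξ ⊗ μ (⊖ ξ) ≡ 𝟙
    μ⊗μ⁻≡𝟙 = trans (μ-⊗-μ-⊖ ξ (X-squared m)) (cong ι Nrel-αγ)
    μ²<μ⁻² : μ ξ ⊗ μ ξ <ᴿ μ (⊖ ξ) ⊗ μ (⊖ ξ)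
    μ²<μ⁻² = subst Pos (sym (μ-⊖-square-difference ξ))
               (Pos-⊗ (Pos-⊕ 2ξ 2ξ Pos-2ξ Pos-2ξ) (trans (sgn-ι (α ⊗ γ)) (subst (λ t → Pos (t ⊗ q)) (sym α≡p) Pos-pq)))
    e : R (suc m)
    e = abs (μ (⊖ ξ))
    𝟙<e : 𝟙 <ᴿ e
    𝟙<e = proj₂ (unit-split μ⊗μ⁻≡𝟙 μ²<μ⁻²)
    Pos-e^ : ∀ j → Pos (e ^ j)
    Pos-e^ j = 0<⇒Pos (<-≤-trans (Pos⇒0< (Pos-𝟙 (suc m))) (𝟙≤^ (<⇒≤ 𝟙<e) j))

  -- Along k = 2j + i, |L ξ k| = |μ ξ|^j |L ξ i| shrinks exactly as |L (⊖ ξ) k| = e^j |L (⊖ ξ) i| grows.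
  close-when-grown : ∀ M i j → (2ξ ⊗ fromℕ (suc M) ⊕ 𝟙) ⊗ abs (L ξ i) <ᴿ e ^ j ⊗ (e ^ j ⊗ abs (L (⊖ ξ) i)) →
                     fromℕ (suc M) ⊗ abs (L ξ (j ℕ.* 2 ℕ.+ i)) <ᴿ abs (Q (j ℕ.* 2 ℕ.+ i))
  close-when-grown M i j grown = *-cancelˡ-< Pos-2ξ (+-cancelʳ-< (abs Lₖ) (begin-strict
    2ξ ⊗ (F ⊗ abs Lₖ) ⊕ abs Lₖ     ≡⟨ trans (cong (2ξ ⊗ (F ⊗ abs Lₖ) ⊕_) (sym (*-identityˡ _)))
                                      (solve 4 (λ x f o l → x :* (f :* l) :+ o :* l := (x :* f :+ o) :* l) refl 2ξ F 𝟙 (abs Lₖ)) ⟩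
    G ⊗ abs Lₖ                    <⟨ *-cancelˡ-< (Pos-e^ j) (subst₂ _<ᴿ_ (sym w[G|Lₖ|]≡) (cong (w ⊗_) (sym |L′ₖ|≡)) grown) ⟩
    abs L′ₖ                       ≡⟨ cong abs (solve 2 (λ a b → a := (a :- b) :+ b) refl L′ₖ Lₖ) ⟩
    abs ((L′ₖ ⊝ Lₖ) ⊕ Lₖ)         ≤⟨ abs-triangle _ _ ⟩
    abs (L′ₖ ⊝ Lₖ) ⊕ abs Lₖ       ≡⟨ cong (λ z → abs z ⊕ abs Lₖ) (L-⊖-difference ξ k) ⟩
    abs (2ξ ⊗ Q k) ⊕ abs Lₖ       ≡⟨ cong (_⊕ abs Lₖ) (trans (abs-⊗ 2ξ (Q k)) (cong (_⊗ abs (Q k)) (abs-NonNeg 2ξ (inj₁ Pos-2ξ)))) ⟩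
    2ξ ⊗ abs (Q k) ⊕ abs Lₖ       ∎))
    where
    open ≤-Reasoning
    F : R (suc m)
    F = fromℕ (suc M)
    G : R (suc m)
    G = 2ξ ⊗ F ⊕ 𝟙
    k : ℕ
    k = j ℕ.* 2 ℕ.+ i
    Lₖ : R (suc m)
    Lₖ = L ξ k
    L′ₖ : R (suc m)
    L′ₖ = L (⊖ ξ) k
    w : R (suc m)
    w = e ^ j
    |Lₖ|≡ : abs Lₖ ≡ abs (μ ξ) ^ j ⊗ abs (L ξ i)
    |Lₖ|≡ = abs-L-power ξ (X-squared m) (E≡𝟘 ξ) j i
    |L′ₖ|≡ : abs L′ₖ ≡ w ⊗ abs (L (⊖ ξ) i)
    |L′ₖ|≡ = abs-L-power (⊖ ξ) (⊖X-squared m) (E≡𝟘 (⊖ ξ)) j i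
    w̄⊗w≡𝟙 : abs (μ ξ) ^ j ⊗ w ≡ 𝟙
    w̄⊗w≡𝟙 = trans (sym (^-distrib-* (abs (μ ξ)) e j)) (trans (cong (_^ j) (abs-unit μ⊗μ⁻≡𝟙)) (𝟙^ j))
    w[G|Lₖ|]≡ : w ⊗ (G ⊗ abs Lₖ) ≡ G ⊗ abs (L ξ i)
    w[G|Lₖ|]≡ = begin-equality
      w ⊗ (G ⊗ abs Lₖ)                           ≡⟨ cong (λ t → w ⊗ (G ⊗ t)) |Lₖ|≡ ⟩
      w ⊗ (G ⊗ (abs (μ ξ) ^ j ⊗ abs (L ξ i)))    ≡⟨ solve 4 (λ w g b l → w :* (g :* (b :* l)) := (b :* w) :* (g :* l)) refl w G _ _ ⟩
      (abs (μ ξ) ^ j ⊗ w) ⊗ (G ⊗ abs (L ξ i))    ≡⟨ trans (cong (_⊗ (G ⊗ abs (L ξ i))) w̄⊗w≡𝟙) (*-identityˡ _) ⟩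
      G ⊗ abs (L ξ i)                            ∎

  Pos-|L⁻| : ∀ i → i ℕ.< 2 → Pos (abs (L (⊖ ξ) i))
  Pos-|L⁻| 0 _ = Pos-abs _ λ L⁻₀≡𝟘 → BO.Pos⇒≢zer (Pos-𝟙 m) (BO.≡𝟘⇒sgn≡zer (cong proj₂ (trans (sym L⁻₀≡) L⁻₀≡𝟘)))
    where
    L⁻₀≡ : L (⊖ ξ) 0 ≡ (d , 𝟙)
    L⁻₀≡ = trans (cong (ι d ⊕_) (solve 2 (λ x y → :- ((:- x) :* y) := x :* y) refl ξ (ι 𝟙))) (ι⊕X⊗ι d 𝟙)
  Pos-|L⁻| 1 _ = subst (λ t → Pos (abs t)) (sym (L-1 (⊖ ξ))) (0<⇒Pos (<-trans (Pos⇒0< (Pos-𝟙 (suc m))) 𝟙<e))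
  Pos-|L⁻| (suc (suc _)) (ℕ.s≤s (ℕ.s≤s ()))

  eventually-close : ∀ M i → i ℕ.< 2 →
                     ∃ λ J → ∀ j → J ℕ.≤ j → fromℕ (suc M) ⊗ abs (L ξ (j ℕ.* 2 ℕ.+ i)) <ᴿ abs (Q (j ℕ.* 2 ℕ.+ i))
  eventually-close M i i<2 =
    let J , below = ^-unbounded 𝟙<e (G ⊗ abs (L ξ i)) (abs (L (⊖ ξ) i)) (Pos-|L⁻| i i<2)
    in J , λ j J≤j → close-when-grown M i j (<-≤-trans (below j J≤j) (*-monoˡ-≤ (inj₁ (Pos-e^ j)) (B≤e^j⊗B j)))
    where
    G : R (suc m)
    G = 2ξ ⊗ fromℕ (suc M) ⊕ 𝟙
    B≤e^j⊗B : ∀ j → abs (L (⊖ ξ) i) ≤ᴿ e ^ j ⊗ abs (L (⊖ ξ) i)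
    B≤e^j⊗B j = subst (_≤ᴿ e ^ j ⊗ abs (L (⊖ ξ) i)) (*-identityˡ _)
                  (*-mono-≤ NonNeg-𝟙 (𝟙≤^ (<⇒≤ 𝟙<e) j) (NonNeg-abs _) ≤-refl)

  converges : CFEquals ξ c
  converges M = eventually-by-parity (eventually-close M 0 (ℕ.s≤s ℕ.z≤n)) (eventually-close M 1 (ℕ.s≤s (ℕ.s≤s ℕ.z≤n)))

theorem3p1 : (m : ℕ) →
    (∀ (a₀ a₁ a₂ : R m) →
       HasType (cfSeq a₀ a₁ a₂) 1 2 →
       CFEquals (X (suc m)) (cfSeq a₀ a₁ a₂) →
       Σ (R (suc m)) λ ε → InRE⁺ ε
         × (q ε ⊗ a₀ ≡ p ε ⊝ 𝟙)
         × (a₁ ≡ q ε)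
         × (q ε ⊗ a₂ ≡ two ⊗ (p ε ⊝ 𝟙))
         × Pos (p ε ⊗ q ε))
    × (∀ (ε : R (suc m)) → InRE⁺ ε →
       (d : Divides (q ε) (p ε ⊝ 𝟙)) →
       Pos (p ε ⊗ q ε) →
       CFEquals (X (suc m)) (cfSeq (quot d) (q ε) (two ⊗ quot d)))
theorem3p1 m = PeriodicExpansion.periodic-expansion⇒unit , λ ε N≡𝟙 (d , p⊝𝟙≡qd) → UnitExpansion.converges (p ε) (q ε) d N≡𝟙 p⊝𝟙≡qd
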